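{- There is no line $\ell$ of $\mathrm{PG}(3,q)$ with plane orbit distribution $OD_2(\ell)=[1,0,0,d_2,e_2]$ where $d_2\ge1$.
   Context: Let $q$ be a power of an odd prime with $3\nmid q$. In $\mathrm{PG}(3,q)$, let $\mathcal{C}=\{(1,t,t^2,t^3): t\in\mathbb{F}_q\}\cup\{(0,0,0,1)\}$ be the twisted cubic. The osculating plane of $\mathcal C$ at $(1,t,t^2,t^3)$ is $-t^3Y_0+3t^2Y_1-3tY_2+Y_3=0$, and at $(0,0,0,1)$ it is $Y_0=0$. All planes are $\mathbb F_q$-rational. Plane classes: $\mathcal H_1$ = osculating planes; $\mathcal H_2$ = non-osculating planes meeting $\mathcal C$ in exactly two points; $\mathcal H_3$ = planes meeting $\mathcal C$ in exactly three points; $\mathcal H_4$ = non-osculating planes meeting $\mathcal C$ in exactly one point; $\mathcal H_5$ = planes disjoint from $\mathcal C$. For a line $\ell$, $OD_2(\ell)=[a_2,b_2,c_2,d_2,e_2]$ lists the numbers of planes through $\ell$ in $\mathcal H_1,\dots,\mathcal H_5$. -}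

module Defs where

open import Level using (0ℓ)
open import Data.Nat as ℕ using (ℕ; zero; suc)
open import Data.Product using (Σ; ∃; _×_; _,_)
open import Data.List using (List; []; _∷_; length; filter; concatMap; map)
open import Data.List.Membership.Propositional using (_∈_)
open import Data.List.Relation.Unary.Unique.Propositional using (Unique)
open import Data.List.Relation.Unary.Any using (Any; any?)
open import Relation.Binary.PropositionalEquality using (_≡_; _≢_)
open import Relation.Binary.Definitions using (DecidableEquality)
open import Relation.Nullary using (Dec; yes; no; ¬_)
open import Relation.Nullary.Decidable using (_×-dec_; ¬?)
open import Algebra.Structures using (IsCommutativeRing)

record FiniteField : Set₁ where
  field
    Carrier : Set
    _+_ _*_ : Carrier → Carrier → Carrier
    -_      : Carrier → Carrier
    0# 1#   : Carrier
    isCommutativeRing : IsCommutativeRing _≡_ _+_ _*_ -_ 0# 1#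
    0≢1     : 0# ≢ 1#
    inverse : ∀ x → x ≢ 0# → ∃ λ y → x * y ≡ 1#
    _≟_     : DecidableEquality Carrier
    elems   : List Carrier
    complete : ∀ x → x ∈ elems
    unique  : Unique elems

  infixl 6 _+_
  infixl 7 _*_

  order : ℕ
  order = length elems

module PG3 (F : FiniteField) where
  open FiniteField F

  -- homogeneous coordinates of points / planes of PG(3,q): F^4
  record V4 : Set where
    constructor ⟨_,_,_,_⟩
    field
      c0 c1 c2 c3 : Carrier
  open V4 public

  3# : Carrier
  3# = 1# + 1# + 1#

  zero4 : V4
  zero4 = ⟨ 0# , 0# , 0# , 0# ⟩

  _·_ : Carrier → V4 → V4
  a · ⟨ x0 , x1 , x2 , x3 ⟩ = ⟨ a * x0 , a * x1 , a * x2 , a * x3 ⟩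

  _⊕_ : V4 → V4 → V4
  ⟨ x0 , x1 , x2 , x3 ⟩ ⊕ ⟨ y0 , y1 , y2 , y3 ⟩ =
    ⟨ x0 + y0 , x1 + y1 , x2 + y2 , x3 + y3 ⟩

  -- incidence: point with coordinates X lies on plane with coordinates Y
  -- iff Y0 X0 + Y1 X1 + Y2 X2 + Y3 X3 = 0
  inner : V4 → V4 → Carrier
  inner ⟨ y0 , y1 , y2 , y3 ⟩ ⟨ x0 , x1 , x2 , x3 ⟩ =
    y0 * x0 + y1 * x1 + y2 * x2 + y3 * x3

  _≟4_ : DecidableEquality V4
  ⟨ x0 , x1 , x2 , x3 ⟩ ≟4 ⟨ y0 , y1 , y2 , y3 ⟩ with x0 ≟ y0 | x1 ≟ y1 | x2 ≟ y2 | x3 ≟ y3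
  ... | yes _≡_.refl | yes _≡_.refl | yes _≡_.refl | yes _≡_.refl = yes _≡_.refl
  ... | no p | _ | _ | _ = no λ { _≡_.refl → p _≡_.refl }
  ... | yes _ | no p | _ | _ = no λ { _≡_.refl → p _≡_.refl }
  ... | yes _ | yes _ | no p | _ = no λ { _≡_.refl → p _≡_.refl }
  ... | yes _ | yes _ | yes _ | no p = no λ { _≡_.refl → p _≡_.refl }

  allV4 : List V4
  allV4 = concatMap (λ a → concatMap (λ b → concatMap (λ c → map (λ d → ⟨ a , b , c , d ⟩)
            elems) elems) elems) elems

  -- Planes of PG(3,q) are represented by their normalized homogeneous
  -- coordinates: the first nonzero coordinate equals 1.  Each plane has
  -- exactly one such representative.
  Normalized : V4 → Set
  Normalized ⟨ y0 , y1 , y2 , y3 ⟩ =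
    (y0 ≡ 1#) ⊎' ((y0 ≡ 0#) × (((y1 ≡ 1#) ⊎' ((y1 ≡ 0#) × ((y2 ≡ 1#) ⊎' ((y2 ≡ 0#) × (y3 ≡ 1#)))))))
    where
    open import Data.Sum using () renaming (_⊎_ to _⊎'_)

  normalized? : ∀ v → Dec (Normalized v)
  normalized? ⟨ y0 , y1 , y2 , y3 ⟩ =
    (y0 ≟ 1#) ⊎-dec ((y0 ≟ 0#) ×-dec ((y1 ≟ 1#) ⊎-dec ((y1 ≟ 0#) ×-dec ((y2 ≟ 1#) ⊎-dec ((y2 ≟ 0#) ×-dec (y3 ≟ 1#))))))
    where
    open import Relation.Nullary.Decidable using (_⊎-dec_)

  planes : List V4
  planes = filter normalized? allV4

  Proportional : V4 → V4 → Set
  Proportional u v = Any (λ c → (c ≢ 0#) × (u ≡ c · v)) elems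

  proportional? : ∀ u v → Dec (Proportional u v)
  proportional? u v = any? (λ c → ¬? (c ≟ 0#) ×-dec (u ≟4 (c · v))) elems

  -- the twisted cubic C = {(1,t,t^2,t^3)} ∪ {(0,0,0,1)}
  cubicPt : Carrier → V4
  cubicPt t = ⟨ 1# , t , t * t , t * t * t ⟩

  P∞ : V4
  P∞ = ⟨ 0# , 0# , 0# , 1# ⟩

  oscPlane : Carrier → V4
  oscPlane t = ⟨ - (t * t * t) , 3# * (t * t) , - (3# * t) , 1# ⟩

  oscPlane∞ : V4
  oscPlane∞ = ⟨ 1# , 0# , 0# , 0# ⟩

  Osculating : V4 → Set
  Osculating π = Any (λ t → Proportional π (oscPlane t)) elems ⊎' Proportional π oscPlane∞
    where
    open import Data.Sum using () renaming (_⊎_ to _⊎'_)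

  osculating? : ∀ π → Dec (Osculating π)
  osculating? π = any? (λ t → proportional? π (oscPlane t)) elems ⊎-dec proportional? π oscPlane∞
    where
    open import Relation.Nullary.Decidable using (_⊎-dec_)

  #C∩ : V4 → ℕ
  #C∩ π = length (filter (λ t → inner π (cubicPt t) ≟ 0#) elems)
          ℕ.+ (if⌊ inner π P∞ ≟ 0# ⌋)
    where
    if⌊_⌋ : ∀ {P : Set} → Dec P → ℕ
    if⌊ yes _ ⌋ = 1
    if⌊ no _ ⌋ = 0

  H1 H2 H3 H4 H5 : V4 → Set
  H1 π = Osculating π
  H2 π = ¬ Osculating π × #C∩ π ≡ 2
  H3 π = #C∩ π ≡ 3
  H4 π = ¬ Osculating π × #C∩ π ≡ 1
  H5 π = #C∩ π ≡ 0

  H1? : ∀ π → Dec (H1 π)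
  H1? = osculating?
  H2? : ∀ π → Dec (H2 π)
  H2? π = ¬? (osculating? π) ×-dec (#C∩ π ℕ.≟ 2)
  H3? : ∀ π → Dec (H3 π)
  H3? π = #C∩ π ℕ.≟ 3
  H4? : ∀ π → Dec (H4 π)
  H4? π = ¬? (osculating? π) ×-dec (#C∩ π ℕ.≟ 1)
  H5? : ∀ π → Dec (H5 π)
  H5? π = #C∩ π ℕ.≟ 0

  -- A line ℓ of PG(3,q) is spanned by two linearly independent vectors P, Q.
  Independent : V4 → V4 → Set
  Independent P Q = ∀ a b → (a · P) ⊕ (b · Q) ≡ zero4 → (a ≡ 0#) × (b ≡ 0#)

  Contains : V4 → V4 → V4 → Set
  Contains P Q π = (inner π P ≡ 0#) × (inner π Q ≡ 0#)

  contains? : ∀ P Q π → Dec (Contains P Q π)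
  contains? P Q π = (inner π P ≟ 0#) ×-dec (inner π Q ≟ 0#)

  -- OD_2(ℓ) = [a2,b2,c2,d2,e2] for ℓ = ⟨P,Q⟩
  a₂ b₂ c₂ d₂ e₂ : V4 → V4 → ℕ
  a₂ P Q = length (filter (λ π → contains? P Q π ×-dec H1? π) planes)
  b₂ P Q = length (filter (λ π → contains? P Q π ×-dec H2? π) planes)
  c₂ P Q = length (filter (λ π → contains? P Q π ×-dec H3? π) planes)
  d₂ P Q = length (filter (λ π → contains? P Q π ×-dec H4? π) planes)
  e₂ P Q = length (filter (λ π → contains? P Q π ×-dec H5? π) planes)

-- A line ℓ lying in exactly one osculating plane and in no plane of H₂ or H₃ lies in no
-- plane meeting the twisted cubic C in two points: an osculating plane meets C only at its
-- point of contact, and a nonzero plane meets C in at most three points.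
-- A projectivity preserving C moves the osculating plane through ℓ to Y₀ = 0. The planes
-- through ℓ are then ⟨ l , n ⟩ with n the cross product of the last three coordinates of two
-- points spanning ℓ, and such a plane meets C at t iff l + G(t) = 0 for the cubic
-- G(t) = n₃t³ + n₂t² + n₁t (and at (0,0,0,1) iff n₃ = 0). If n₃ = 0 the plane l = 0 meets C
-- twice. Otherwise, as the characteristic is neither 2 nor 3, either G takes some value twice,
-- giving a secant plane through ℓ, or G(t) = n₃(t − τ)³ + const, so that ℓ also lies in the
-- osculating plane at τ. Collisions of G come from writing elements of F as U² + 3W²,
-- which is always possible by a pigeonhole count.

module Submission where

open import Defs
open import Data.Nat using (ℕ; _≥_)
open import Data.Nat.Divisibility using (_∣_)
open import Data.Product using (_×_)
open import Relation.Nullary using (¬_)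
open import Relation.Binary.PropositionalEquality using (_≡_)

open import Level using (0ℓ)
open import Function using (id; _∘_)
open import Function.Bundles using (mk⇔)
open import Data.Empty using (⊥; ⊥-elim)
open import Data.Product using (∃; ∃₂; _,_; proj₁; proj₂)
open import Data.Sum using (_⊎_; inj₁; inj₂; [_,_]′)
open import Data.Maybe using (Maybe; just; nothing)
import Data.Maybe
import Data.Maybe.Properties as Maybe
open import Data.Nat as ℕ using (zero; suc; s≤s; z≤n)
import Data.Nat.Properties as ℕ
open import Data.Nat.Divisibility using (m%n≡0⇒n∣m)
open import Data.Nat.DivMod using (m%n<n; m≡m%n+[m/n]*n)
open import Data.Integer as ℤ using (ℤ; -[1+_])
import Data.Integer.Properties as ℤ
open import Data.Sign using (Sign)
open import Data.Fin as Fin using (Fin)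
import Data.Fin.Properties as Fin
open import Data.List as List using (List; []; _∷_; length; map; foldr; filter)
open import Data.List.Membership.Propositional using (_∈_)
open import Data.List.Membership.Propositional.Properties
  using (∈-map⁺; ∈-concatMap⁺; ∈-filter⁺; ∈-filter⁻; ∈-lookup)
open import Data.List.Membership.Propositional.Properties.WithK using (unique∧set⇒bag)
import Data.List.Relation.Unary.Any as Any
import Data.List.Relation.Unary.Any.Properties as Any
open import Data.List.Relation.Unary.Any using (here; there)
open import Data.List.Relation.Unary.All as All using (All; _∷_)
import Data.List.Relation.Unary.All.Properties as All
open import Data.List.Relation.Unary.AllPairs using (_∷_)
open import Data.List.Relation.Unary.Unique.Propositional using (Unique)
import Data.List.Relation.Unary.Unique.Propositional.Properties as Unique
open import Data.List.Relation.Binary.Permutation.Propositional using (_↭_; ↭⇒↭ₛ)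
import Data.List.Relation.Binary.Permutation.Setoid.Properties as Perm
open import Data.List.Relation.Binary.BagAndSetEquality using (∼bag⇒↭)
open import Relation.Nullary using (Dec; yes; no)
open import Relation.Nullary.Decidable using (_×-dec_)
open import Relation.Unary using (Decidable)
open import Relation.Binary.PropositionalEquality
open import Algebra.Bundles using (CommutativeRing)
import Algebra.Properties.Ring as RingProperties
import Algebra.Solver.Ring.AlmostCommutativeRing as ACR
import Algebra.Solver.Ring as RingSolver

module _ {A : Set} where

  length≥1 : ∀ {xs : List A} {x} → x ∈ xs → 1 ℕ.≤ length xs
  length≥1 (here _)  = s≤s z≤n
  length≥1 (there _) = s≤s z≤n

  length≥2 : ∀ {xs : List A} {x y} → x ≢ y → x ∈ xs → y ∈ xs → 2 ℕ.≤ length xs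
  length≥2 x≢y (here refl) (here refl) = ⊥-elim (x≢y refl)
  length≥2 x≢y (here refl) (there y∈) = s≤s (length≥1 y∈)
  length≥2 x≢y (there x∈)  (here refl) = s≤s (length≥1 x∈)
  length≥2 x≢y (there x∈)  (there y∈) = ℕ.m≤n⇒m≤1+n (length≥2 x≢y x∈ y∈)

  length≤2 : ∀ {P : A → Set} {xs} → Unique xs → All P xs →
             (∀ {a b c} → a ≢ b → a ≢ c → b ≢ c → P a → P b → P c → ⊥) → length xs ℕ.≤ 2
  length≤2 {xs = []}              _ _ _ = z≤n
  length≤2 {xs = _ ∷ []}          _ _ _ = s≤s z≤n
  length≤2 {xs = _ ∷ _ ∷ []}      _ _ _ = s≤s (s≤s z≤n)
  length≤2 {xs = _ ∷ _ ∷ _ ∷ _} ((a≢b ∷ a≢c ∷ _) ∷ (b≢c ∷ _) ∷ _) (pa ∷ pb ∷ pc ∷ _) no-three =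
    ⊥-elim (no-three a≢b a≢c b≢c pa pb pc)

  length≤3 : ∀ {P : A → Set} {xs} → Unique xs → All P xs →
             (∀ {a b c d} → a ≢ b → a ≢ c → a ≢ d → b ≢ c → b ≢ d → c ≢ d → P a → P b → P c → P d → ⊥) →
             length xs ℕ.≤ 3
  length≤3 {xs = []}                 _ _ _ = z≤n
  length≤3 {xs = _ ∷ []}             _ _ _ = s≤s z≤n
  length≤3 {xs = _ ∷ _ ∷ []}         _ _ _ = s≤s (s≤s z≤n)
  length≤3 {xs = _ ∷ _ ∷ _ ∷ []}     _ _ _ = s≤s (s≤s (s≤s z≤n))
  length≤3 {xs = _ ∷ _ ∷ _ ∷ _ ∷ _}
    ((a≢b ∷ a≢c ∷ a≢d ∷ _) ∷ (b≢c ∷ b≢d ∷ _) ∷ (c≢d ∷ _) ∷ _) (pa ∷ pb ∷ pc ∷ pd ∷ _) no-four =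
    ⊥-elim (no-four a≢b a≢c a≢d b≢c b≢d c≢d pa pb pc pd)

  length-filter≡0 : ∀ {P : A → Set} (P? : Decidable P) {xs x} → length (filter P? xs) ≡ 0 → x ∈ xs → ¬ P x
  length-filter≡0 P? {xs} len≡0 x∈ px with filter P? xs | ∈-filter⁺ P? x∈ px
  ... | [] | ()

  length-filter≡1 : ∀ {P : A → Set} (P? : Decidable P) {xs} → length (filter P? xs) ≡ 1 →
                    ∃ λ y → y ∈ xs × P y × (∀ {x} → x ∈ xs → P x → x ≡ y)
  length-filter≡1 {P = P} P? {xs} len≡1 with filter P? xs in eq
  ... | y ∷ [] = y , proj₁ (∈-filter⁻ P? {xs = xs} y∈) , proj₂ (∈-filter⁻ P? {xs = xs} y∈) , unique
    where
    y∈ : y ∈ filter P? xs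
    y∈ = subst (y ∈_) (sym eq) (here refl)
    unique : ∀ {x} → x ∈ xs → P x → x ≡ y
    unique x∈ px with subst (_ ∈_) eq (∈-filter⁺ P? x∈ px)
    ... | here x≡y = x≡y

module FieldTheory (F : FiniteField) where
  open FiniteField F public

  commutativeRing : CommutativeRing 0ℓ 0ℓ
  commutativeRing = record { isCommutativeRing = isCommutativeRing }

  open CommutativeRing commutativeRing public
    using ( +-comm; +-assoc; *-comm; *-assoc; +-identityˡ; +-identityʳ
          ; *-identityˡ; *-identityʳ; distribʳ; -‿inverseʳ; zeroˡ; zeroʳ
          ; +-isCommutativeMonoid; ring )
  open RingProperties ring public
    using (-‿distribˡ-*; -‿distribʳ-*; -0#≈0#; -‿involutive; -‿anti-homo-+)

  infixl 6 _-_
  _-_ : Carrier → Carrier → Carrier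
  x - y = x + - y

  2# 3# : Carrier
  2# = 1# + 1#
  3# = 1# + 1# + 1#

  -- Chosen so that fromℕ 2 and fromℕ 3 are definitionally 2# and 3#, and the numerals
  -- of the ring solver below evaluate to exactly these terms.
  fromℕ : ℕ → Carrier
  fromℕ 0             = 0#
  fromℕ 1             = 1#
  fromℕ (suc (suc n)) = fromℕ (suc n) + 1#

  fromℕ-suc : ∀ n → fromℕ (suc n) ≡ fromℕ n + 1#
  fromℕ-suc zero    = sym (+-identityˡ 1#)
  fromℕ-suc (suc n) = refl

  fromℕ-+ : ∀ m n → fromℕ (m ℕ.+ n) ≡ fromℕ m + fromℕ n
  fromℕ-+ zero    n = sym (+-identityˡ _)
  fromℕ-+ (suc m) n = begin
    fromℕ (suc (m ℕ.+ n))      ≡⟨ fromℕ-suc (m ℕ.+ n) ⟩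
    fromℕ (m ℕ.+ n) + 1#       ≡⟨ cong (_+ 1#) (fromℕ-+ m n) ⟩
    fromℕ m + fromℕ n + 1#     ≡⟨ +-assoc _ _ _ ⟩
    fromℕ m + (fromℕ n + 1#)   ≡⟨ cong (fromℕ m +_) (+-comm _ _) ⟩
    fromℕ m + (1# + fromℕ n)   ≡⟨ +-assoc _ _ _ ⟨
    fromℕ m + 1# + fromℕ n     ≡⟨ cong (_+ fromℕ n) (fromℕ-suc m) ⟨
    fromℕ (suc m) + fromℕ n    ∎
    where open ≡-Reasoning

  fromℕ-* : ∀ m n → fromℕ (m ℕ.* n) ≡ fromℕ m * fromℕ n
  fromℕ-* zero    n = sym (zeroˡ _)
  fromℕ-* (suc m) n = begin
    fromℕ (n ℕ.+ m ℕ.* n)            ≡⟨ fromℕ-+ n (m ℕ.* n) ⟩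
    fromℕ n + fromℕ (m ℕ.* n)        ≡⟨ cong (fromℕ n +_) (fromℕ-* m n) ⟩
    fromℕ n + fromℕ m * fromℕ n      ≡⟨ cong (_+ fromℕ m * fromℕ n) (*-identityˡ _) ⟨
    1# * fromℕ n + fromℕ m * fromℕ n ≡⟨ distribʳ _ _ _ ⟨
    (1# + fromℕ m) * fromℕ n         ≡⟨ cong (_* fromℕ n) (+-comm _ _) ⟩
    (fromℕ m + 1#) * fromℕ n         ≡⟨ cong (_* fromℕ n) (fromℕ-suc m) ⟨
    fromℕ (suc m) * fromℕ n          ∎
    where open ≡-Reasoning

  fromℤ : ℤ → Carrier
  fromℤ (ℤ.+ n)    = fromℕ n
  fromℤ -[1+ n ]   = - fromℕ (suc n)

  fromℤ-⊖ : ∀ m n → fromℤ (m ℤ.⊖ n) ≡ fromℕ m - fromℕ n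
  fromℤ-⊖ m zero = begin
    fromℤ (m ℤ.⊖ 0)  ≡⟨ cong fromℤ (ℤ.⊖-≥ {m} z≤n) ⟩
    fromℕ m          ≡⟨ sym (+-identityʳ _) ⟩
    fromℕ m + 0#     ≡⟨ cong (fromℕ m +_) (sym -0#≈0#) ⟩
    fromℕ m - 0#     ∎
    where open ≡-Reasoning
  fromℤ-⊖ zero (suc n) = begin
    fromℤ (0 ℤ.⊖ suc n)  ≡⟨ cong fromℤ (ℤ.⊖-< {0} {suc n} ℕ.z<s) ⟩
    - fromℕ (suc n)      ≡⟨ sym (+-identityˡ _) ⟩
    0# - fromℕ (suc n)   ∎
    where open ≡-Reasoning
  fromℤ-⊖ (suc m) (suc n) = begin
    fromℤ (suc m ℤ.⊖ suc n)  ≡⟨ cong fromℤ (ℤ.[1+m]⊖[1+n]≡m⊖n m n) ⟩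
    fromℤ (m ℤ.⊖ n)          ≡⟨ fromℤ-⊖ m n ⟩
    a - b                    ≡⟨ cancel-1 ⟨
    (a + 1#) - (b + 1#)      ≡⟨ cong₂ _-_ (fromℕ-suc m) (fromℕ-suc n) ⟨
    fromℕ (suc m) - fromℕ (suc n) ∎
    where
    open ≡-Reasoning
    a b : Carrier
    a = fromℕ m
    b = fromℕ n
    cancel-1 : (a + 1#) - (b + 1#) ≡ a - b
    cancel-1 = begin
      (a + 1#) + - (b + 1#)    ≡⟨ cong ((a + 1#) +_) (trans (cong -_ (+-comm b 1#)) (-‿anti-homo-+ 1# b)) ⟩
      (a + 1#) + (- b - 1#)    ≡⟨ +-assoc a 1# _ ⟩
      a + (1# + (- b - 1#))    ≡⟨ cong (λ z → a + (1# + z)) (+-comm (- b) (- 1#)) ⟩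
      a + (1# + (- 1# - b))    ≡⟨ cong (a +_) (+-assoc 1# (- 1#) (- b)) ⟨
      a + ((1# - 1#) - b)      ≡⟨ cong (λ z → a + (z - b)) (-‿inverseʳ 1#) ⟩
      a + (0# - b)             ≡⟨ cong (a +_) (+-identityˡ (- b)) ⟩
      a - b                    ∎

  fromℤ-+◃ : ∀ n → fromℤ (Sign.+ ℤ.◃ n) ≡ fromℕ n
  fromℤ-+◃ zero    = refl
  fromℤ-+◃ (suc n) = refl

  fromℤ--◃ : ∀ n → fromℤ (Sign.- ℤ.◃ n) ≡ - fromℕ n
  fromℤ--◃ zero    = sym -0#≈0#
  fromℤ--◃ (suc n) = refl

  fromℤ-+ : ∀ i j → fromℤ (i ℤ.+ j) ≡ fromℤ i + fromℤ j
  fromℤ-+ (ℤ.+ m)  (ℤ.+ n)  = fromℕ-+ m n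
  fromℤ-+ (ℤ.+ m)  -[1+ n ] = fromℤ-⊖ m (suc n)
  fromℤ-+ -[1+ m ] (ℤ.+ n)  = trans (fromℤ-⊖ n (suc m)) (+-comm _ _)
  fromℤ-+ -[1+ m ] -[1+ n ] = begin
    - fromℕ (suc (suc (m ℕ.+ n)))      ≡⟨ cong (λ k → - fromℕ (suc k)) (ℕ.+-suc m n) ⟨
    - fromℕ (suc m ℕ.+ suc n)          ≡⟨ cong -_ (fromℕ-+ (suc m) (suc n)) ⟩
    - (fromℕ (suc m) + fromℕ (suc n))  ≡⟨ -‿anti-homo-+ _ _ ⟩
    - fromℕ (suc n) - fromℕ (suc m)    ≡⟨ +-comm _ _ ⟩
    - fromℕ (suc m) - fromℕ (suc n)    ∎
    where open ≡-Reasoning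

  fromℤ-* : ∀ i j → fromℤ (i ℤ.* j) ≡ fromℤ i * fromℤ j
  fromℤ-* (ℤ.+ m)  (ℤ.+ n)  = trans (fromℤ-+◃ (m ℕ.* n)) (fromℕ-* m n)
  fromℤ-* (ℤ.+ m)  -[1+ n ] = begin
    fromℤ (Sign.- ℤ.◃ m ℕ.* suc n)  ≡⟨ fromℤ--◃ (m ℕ.* suc n) ⟩
    - fromℕ (m ℕ.* suc n)           ≡⟨ cong -_ (fromℕ-* m (suc n)) ⟩
    - (fromℕ m * fromℕ (suc n))     ≡⟨ -‿distribʳ-* _ _ ⟩
    fromℕ m * - fromℕ (suc n)       ∎
    where open ≡-Reasoning
  fromℤ-* -[1+ m ] (ℤ.+ n)  = begin
    fromℤ (Sign.- ℤ.◃ suc m ℕ.* n)  ≡⟨ fromℤ--◃ (suc m ℕ.* n) ⟩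
    - fromℕ (suc m ℕ.* n)           ≡⟨ cong -_ (fromℕ-* (suc m) n) ⟩
    - (fromℕ (suc m) * fromℕ n)     ≡⟨ -‿distribˡ-* _ _ ⟩
    - fromℕ (suc m) * fromℕ n       ∎
    where open ≡-Reasoning
  fromℤ-* -[1+ m ] -[1+ n ] = begin
    fromℕ (suc m ℕ.* suc n)              ≡⟨ fromℕ-* (suc m) (suc n) ⟩
    fromℕ (suc m) * fromℕ (suc n)        ≡⟨ -‿involutive _ ⟨
    - - (fromℕ (suc m) * fromℕ (suc n))  ≡⟨ cong -_ (-‿distribˡ-* _ _) ⟩
    - (- fromℕ (suc m) * fromℕ (suc n))  ≡⟨ -‿distribʳ-* _ _ ⟩
    - fromℕ (suc m) * - fromℕ (suc n)    ∎
    where open ≡-Reasoning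

  fromℤ-- : ∀ i → fromℤ (ℤ.- i) ≡ - fromℤ i
  fromℤ-- (ℤ.+ zero)    = sym -0#≈0#
  fromℤ-- (ℤ.+ suc n)   = refl
  fromℤ-- -[1+ n ]      = sym (-‿involutive _)

  private
    almostCommutativeRing : ACR.AlmostCommutativeRing 0ℓ 0ℓ
    almostCommutativeRing = ACR.fromCommutativeRing commutativeRing

    fromℤ-morphism : ℤ.+-*-rawRing ACR.-Raw-AlmostCommutative⟶ almostCommutativeRing
    fromℤ-morphism = record
      { ⟦_⟧ = fromℤ ; +-homo = fromℤ-+ ; *-homo = fromℤ-* ; -‿homo = fromℤ--
      ; 0-homo = refl ; 1-homo = refl }

    fromℤ-weaklyDecidable : ∀ i j → Maybe (fromℤ i ≡ fromℤ j)
    fromℤ-weaklyDecidable i j with i ℤ.≟ j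
    ... | yes refl = just refl
    ... | no _     = nothing

  open RingSolver ℤ.+-*-rawRing almostCommutativeRing fromℤ-morphism fromℤ-weaklyDecidable public
    using (Polynomial; solve; _:=_; con; _:+_; _:*_; _:-_; :-_)

  κ : ∀ {n} → ℕ → Polynomial n
  κ k = con (ℤ.+ k)

  1≢0 : 1# ≢ 0#
  1≢0 e = 0≢1 (sym e)

  *-cancelˡ-≡0 : ∀ {x y} → x ≢ 0# → x * y ≡ 0# → y ≡ 0#
  *-cancelˡ-≡0 {x} {y} x≢0 xy≡0 with inverse x x≢0
  ... | x⁻¹ , xx⁻¹≡1 = begin
    y               ≡⟨ solve 3 (λ x x⁻¹ y → y := x⁻¹ :* (x :* y) :+ (κ 1 :- x :* x⁻¹) :* y) refl x x⁻¹ y ⟩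
    x⁻¹ * (x * y) + (1# - x * x⁻¹) * y  ≡⟨ cong₂ (λ u v → x⁻¹ * u + (1# - v) * y) xy≡0 xx⁻¹≡1 ⟩
    x⁻¹ * 0# + (1# - 1#) * y            ≡⟨ solve 2 (λ x⁻¹ y → x⁻¹ :* κ 0 :+ (κ 1 :- κ 1) :* y := κ 0) refl x⁻¹ y ⟩
    0#              ∎
    where open ≡-Reasoning

  *-≡0 : ∀ {x y} → x * y ≡ 0# → x ≡ 0# ⊎ y ≡ 0#
  *-≡0 {x} xy≡0 with x ≟ 0#
  ... | yes x≡0 = inj₁ x≡0
  ... | no  x≢0 = inj₂ (*-cancelˡ-≡0 x≢0 xy≡0)

  *-≢0 : ∀ {x y} → x ≢ 0# → y ≢ 0# → x * y ≢ 0#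
  *-≢0 x≢0 y≢0 xy≡0 = [ x≢0 , y≢0 ]′ (*-≡0 xy≡0)

  square-≡0 : ∀ {x} → x * x ≡ 0# → x ≡ 0#
  square-≡0 e = [ id , id ]′ (*-≡0 e)

  cube-≡0 : ∀ {x} → x * x * x ≡ 0# → x ≡ 0#
  cube-≡0 e = [ square-≡0 , id ]′ (*-≡0 e)

  inverse-≢0 : ∀ {x y} → x * y ≡ 1# → y ≢ 0#
  inverse-≢0 {x} xy≡1 y≡0 = 1≢0 (trans (sym xy≡1) (trans (cong (x *_) y≡0) (zeroʳ x)))

  -‿≡0⇒≡0 : ∀ {x} → - x ≡ 0# → x ≡ 0#
  -‿≡0⇒≡0 {x} e = trans (sym (-‿involutive x)) (trans (cong -_ e) -0#≈0#)

  ≡0⇒-‿≡0 : ∀ {x} → x ≡ 0# → - x ≡ 0#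
  ≡0⇒-‿≡0 refl = -0#≈0#

  -≡0⇒≡ : ∀ {x y} → x - y ≡ 0# → x ≡ y
  -≡0⇒≡ {x} {y} e = begin
    x            ≡⟨ solve 2 (λ x y → x := (x :- y) :+ y) refl x y ⟩
    (x - y) + y  ≡⟨ cong (_+ y) e ⟩
    0# + y       ≡⟨ +-identityˡ y ⟩
    y            ∎
    where open ≡-Reasoning

  ≡⇒-≡0 : ∀ {x y} → x ≡ y → x - y ≡ 0#
  ≡⇒-≡0 {x} refl = -‿inverseʳ x

  square-injective-up-to-sign : ∀ {u v} → u * u ≡ v * v → u ≡ v ⊎ u ≡ - v
  square-injective-up-to-sign {u} {v} e with *-≡0 {u - v} {u + v} (begin
    (u - v) * (u + v)  ≡⟨ solve 2 (λ u v → (u :- v) :* (u :+ v) := u :* u :- v :* v) refl u v ⟩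
    u * u - v * v      ≡⟨ ≡⇒-≡0 e ⟩
    0#                 ∎)
    where open ≡-Reasoning
  ... | inj₁ u-v≡0 = inj₁ (-≡0⇒≡ u-v≡0)
  ... | inj₂ u+v≡0 = inj₂ (-≡0⇒≡ (trans (solve 2 (λ u v → u :- :- v := u :+ v) refl u v) u+v≡0))

  sum : List Carrier → Carrier
  sum = foldr _+_ 0#

  sum-map-+1 : ∀ xs → sum (map (_+ 1#) xs) ≡ sum xs + fromℕ (length xs)
  sum-map-+1 [] = sym (+-identityˡ 0#)
  sum-map-+1 (x ∷ xs) = begin
    (x + 1#) + sum (map (_+ 1#) xs)        ≡⟨ cong ((x + 1#) +_) (sum-map-+1 xs) ⟩
    (x + 1#) + (sum xs + fromℕ (length xs)) ≡⟨ solve 3 (λ x s n → (x :+ κ 1) :+ (s :+ n) := (x :+ s) :+ (n :+ κ 1))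
                                                   refl x (sum xs) (fromℕ (length xs)) ⟩
    (x + sum xs) + (fromℕ (length xs) + 1#) ≡⟨ cong ((x + sum xs) +_) (fromℕ-suc (length xs)) ⟨
    (x + sum xs) + fromℕ (suc (length xs))  ∎
    where open ≡-Reasoning

  sum-↭ : ∀ {xs ys} → xs ↭ ys → sum xs ≡ sum ys
  sum-↭ p = Perm.foldr-commMonoid (setoid Carrier) +-isCommutativeMonoid (↭⇒↭ₛ p)

  +1-permutes-elems : map (_+ 1#) elems ↭ elems
  +1-permutes-elems = ∼bag⇒↭ (unique∧set⇒bag (Unique.map⁺ +1-injective unique) unique
    (λ {x} → mk⇔ (λ _ → complete x) (λ _ → subst (_∈ map (_+ 1#) elems) (-1+1 x) (∈-map⁺ (_+ 1#) (complete (x - 1#))))))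
    where
    +1-injective : ∀ {x y} → x + 1# ≡ y + 1# → x ≡ y
    +1-injective {x} {y} e = -≡0⇒≡ (trans (solve 2 (λ x y → x :- y := (x :+ κ 1) :- (y :+ κ 1)) refl x y) (≡⇒-≡0 e))
    -1+1 : ∀ x → x - 1# + 1# ≡ x
    -1+1 = solve 1 (λ x → x :- κ 1 :+ κ 1 := x) refl

  order≡0 : fromℕ order ≡ 0#
  order≡0 = begin
    fromℕ order                          ≡⟨ solve 2 (λ n s → n := (s :+ n) :- s) refl (fromℕ order) (sum elems) ⟩
    (sum elems + fromℕ order) - sum elems ≡⟨ cong (_- sum elems) (sum-map-+1 elems) ⟨
    sum (map (_+ 1#) elems) - sum elems   ≡⟨ cong (_- sum elems) (sum-↭ +1-permutes-elems) ⟩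
    sum elems - sum elems                 ≡⟨ -‿inverseʳ _ ⟩
    0#                                    ∎
    where open ≡-Reasoning

  order%≡0 : ∀ m .{{_ : ℕ.NonZero m}} → fromℕ m ≡ 0# → fromℕ (order ℕ.% m) ≡ 0#
  order%≡0 m m≡0 = begin
    fromℕ r                      ≡⟨ solve 2 (λ r k → r := r :+ k :* κ 0) refl (fromℕ r) (fromℕ k) ⟩
    fromℕ r + fromℕ k * 0#       ≡⟨ cong (λ z → fromℕ r + fromℕ k * z) m≡0 ⟨
    fromℕ r + fromℕ k * fromℕ m  ≡⟨ cong (fromℕ r +_) (fromℕ-* k m) ⟨
    fromℕ r + fromℕ (k ℕ.* m)    ≡⟨ fromℕ-+ r (k ℕ.* m) ⟨
    fromℕ (r ℕ.+ k ℕ.* m)        ≡⟨ cong fromℕ (m≡m%n+[m/n]*n order m) ⟨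
    fromℕ order                  ≡⟨ order≡0 ⟩
    0#                           ∎
    where
    open ≡-Reasoning
    r k : ℕ
    r = order ℕ.% m
    k = order ℕ./ m

  char≢2 : ¬ 2 ∣ order → 2# ≢ 0#
  char≢2 2∤q 2≡0 with order ℕ.% 2 | m%n<n order 2 | order%≡0 2 2≡0 | m%n≡0⇒n∣m order 2
  ... | 0 | _               | _    | 2∣q = 2∤q (2∣q refl)
  ... | 1 | _               | 1≡0  | _   = 1≢0 1≡0
  ... | suc (suc _) | s≤s (s≤s ()) | _ | _

  char≢3 : ¬ 2 ∣ order → ¬ 3 ∣ order → 3# ≢ 0#
  char≢3 2∤q 3∤q 3≡0 with order ℕ.% 3 | m%n<n order 3 | order%≡0 3 3≡0 | m%n≡0⇒n∣m order 3
  ... | 0 | _               | _    | 3∣q = 3∤q (3∣q refl)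
  ... | 1 | _               | 1≡0  | _   = 1≢0 1≡0
  ... | 2 | _               | 2≡0  | _   = char≢2 2∤q 2≡0
  ... | suc (suc (suc _)) | s≤s (s≤s (s≤s ())) | _ | _

  index : Carrier → Fin order
  index x = Any.index (complete x)

  index-injective : ∀ {x y} → index x ≡ index y → x ≡ y
  index-injective {x} {y} e = begin
    x                      ≡⟨ Any.lookup-index (complete x) ⟩
    List.lookup elems (index x) ≡⟨ cong (List.lookup elems) e ⟩
    List.lookup elems (index y) ≡⟨ Any.lookup-index (complete y) ⟨
    y                      ∎
    where open ≡-Reasoning

  lookup-injective : ∀ {xs : List Carrier} → Unique xs → ∀ {i j} → List.lookup xs i ≡ List.lookup xs j → i ≡ j
  lookup-injective (_ ∷ _)     {Fin.zero}  {Fin.zero}  _ = refl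
  lookup-injective (x∉xs ∷ _)  {Fin.zero}  {Fin.suc j} e = ⊥-elim (All.lookup x∉xs (∈-lookup j) e)
  lookup-injective (x∉xs ∷ _)  {Fin.suc i} {Fin.zero}  e = ⊥-elim (All.lookup x∉xs (∈-lookup i) (sym e))
  lookup-injective (_ ∷ uniq)  {Fin.suc i} {Fin.suc j} e = cong Fin.suc (lookup-injective uniq e)

  no-injection-from-Maybe : (f : Maybe Carrier → Carrier) → ¬ (∀ {a b} → f a ≡ f b → a ≡ b)
  no-injection-from-Maybe f f-injective = ℕ.<-irrefl refl (Fin.injective⇒≤ (decode-injective ∘ f-injective ∘ index-injective))
    where
    decode : Fin (suc order) → Maybe Carrier
    decode Fin.zero    = nothing
    decode (Fin.suc i) = just (List.lookup elems i)
    decode-injective : ∀ {i j} → decode i ≡ decode j → i ≡ j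
    decode-injective {Fin.zero}  {Fin.zero}  _ = refl
    decode-injective {Fin.suc i} {Fin.suc j} e = cong Fin.suc (lookup-injective unique (Maybe.just-injective e))

  Representative : Carrier → Set
  Representative u = Fin.toℕ (index u) ℕ.≤ Fin.toℕ (index (- u))

  representative? : ∀ u → Dec (Representative u)
  representative? u = Fin.toℕ (index u) ℕ.≤? Fin.toℕ (index (- u))

  -- If k ≠ u² + c w² for all u, w, then k, the squares u² of the representatives u of the
  -- pairs ±u and the values k − c u² of the other elements u are q + 1 distinct elements of F.
  module Unrepresentable (c k : Carrier) (c≢0 : c ≢ 0#) (no-solution : ∀ u w → u * u + c * (w * w) ≢ k) where
    private
      value : (u : Carrier) → Dec (Representative u) → Carrier
      value u (yes _) = u * u
      value u (no _)  = k - c * (u * u)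

      embed : Maybe Carrier → Carrier
      embed nothing  = k
      embed (just u) = value u (representative? u)

      ≡-neg : ∀ {u v} → u ≡ - v → v ≡ - u
      ≡-neg {u} {v} u≡-v = trans (sym (-‿involutive v)) (cong -_ (sym u≡-v))

      representative-injective : ∀ {u v} → Representative u → Representative v → u * u ≡ v * v → u ≡ v
      representative-injective {u} {v} u∈R v∈R e with square-injective-up-to-sign e
      ... | inj₁ u≡v  = u≡v
      ... | inj₂ u≡-v = index-injective (Fin.toℕ-injective (ℕ.≤-antisym
        (subst (λ z → Fin.toℕ (index u) ℕ.≤ Fin.toℕ (index z)) (sym (≡-neg u≡-v)) u∈R)
        (subst (λ z → Fin.toℕ (index v) ℕ.≤ Fin.toℕ (index z)) (sym u≡-v) v∈R)))

      non-representative-injective : ∀ {u v} → ¬ Representative u → ¬ Representative v → u * u ≡ v * v → u ≡ v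
      non-representative-injective {u} {v} u∉R v∉R e with square-injective-up-to-sign e
      ... | inj₁ u≡v  = u≡v
      ... | inj₂ u≡-v = ⊥-elim (ℕ.<-asym
        (subst (λ z → Fin.toℕ (index z) ℕ.< Fin.toℕ (index u)) (sym (≡-neg u≡-v)) (ℕ.≰⇒> u∉R))
        (subst (λ z → Fin.toℕ (index z) ℕ.< Fin.toℕ (index v)) (sym u≡-v) (ℕ.≰⇒> v∉R)))

      k-c*-injective : ∀ {x y} → k - c * x ≡ k - c * y → x ≡ y
      k-c*-injective {x} {y} e = -≡0⇒≡ (*-cancelˡ-≡0 c≢0 (trans
        (solve 4 (λ c k x y → c :* (x :- y) := (k :- c :* y) :- (k :- c :* x)) refl c k x y)
        (≡⇒-≡0 (sym e))))

      no-mixed : ∀ {u v} → u * u ≢ k - c * (v * v)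
      no-mixed {u} {v} e = no-solution u v (trans (cong (_+ c * (v * v)) e)
        (solve 3 (λ c k v → k :- c :* (v :* v) :+ c :* (v :* v) := k) refl c k v))

      value-injective : ∀ u v du dv → value u du ≡ value v dv → u ≡ v
      value-injective u v (yes u∈R) (yes v∈R) e = representative-injective u∈R v∈R e
      value-injective u v (yes _)  (no _)   e = ⊥-elim (no-mixed e)
      value-injective u v (no _)   (yes _)  e = ⊥-elim (no-mixed (sym e))
      value-injective u v (no u∉R)  (no v∉R)  e = non-representative-injective u∉R v∉R (k-c*-injective e)

      k≢value : ∀ u du → k ≢ value u du
      k≢value u (yes _) e = no-solution u 0#
        (trans (solve 2 (λ c u → u :* u :+ c :* (κ 0 :* κ 0) := u :* u) refl c u) (sym e))
      k≢value u (no u∉R) e = u∉R (subst Representative (sym u≡0) 0∈R)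
        where
        u≡0 : u ≡ 0#
        u≡0 = square-≡0 (sym (trans (sym (zeroˡ 0#))
          (k-c*-injective (trans (solve 2 (λ c k → k :- c :* (κ 0 :* κ 0) := k) refl c k) e))))
        0∈R : Representative 0#
        0∈R = ℕ.≤-reflexive (cong (Fin.toℕ ∘ index) (sym -0#≈0#))

      embed-injective : ∀ {a b} → embed a ≡ embed b → a ≡ b
      embed-injective {nothing} {nothing} _ = refl
      embed-injective {nothing} {just v}  e = ⊥-elim (k≢value v (representative? v) e)
      embed-injective {just u}  {nothing} e = ⊥-elim (k≢value u (representative? u) (sym e))
      embed-injective {just u}  {just v}  e = cong just (value-injective u v (representative? u) (representative? v) e)

    impossible : ⊥
    impossible = no-injection-from-Maybe embed embed-injective

  sum-of-squares : ∀ c → c ≢ 0# → ∀ k → ∃₂ λ u w → u * u + c * (w * w) ≡ k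
  sum-of-squares c c≢0 k with Any.any? (λ u → Any.any? (λ w → (u * u + c * (w * w)) ≟ k) elems) elems
  ... | yes found with Any.satisfied found
  ...   | u , found-w with Any.satisfied found-w
  ...     | w , e = u , w , e
  sum-of-squares c c≢0 k | no none = ⊥-elim (Unrepresentable.impossible c k c≢0 λ u w e →
    none (Any.map (λ { refl → Any.map (λ { refl → e }) (complete w) }) (complete u)))

  cubic : Carrier → Carrier → Carrier → Carrier → Carrier
  cubic a b c x = a * (x * x * x) + b * (x * x) + c * x

  data CubicShape (a b c : Carrier) : Set where
    collision   : ∀ x y → x ≢ y → cubic a b c x ≡ cubic a b c y → CubicShape a b c
    perfectCube : ∀ τ → b ≡ - (3# * a * τ) → c ≡ 3# * a * (τ * τ) → CubicShape a b c

  module _ (2≢0 : 2# ≢ 0#) (3≢0 : 3# ≢ 0#) where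

    norm-off-diagonal : ∀ {k} → k ≢ 0# → ∃₂ λ U W → U ≢ 3# * W × U * U + 3# * (W * W) ≡ k
    norm-off-diagonal {k} k≢0 with sum-of-squares 3# 3≢0 k
    ... | U , W , U²+3W²≡k with U ≟ (3# * W)
    ...   | no  U≢3W = U , W , U≢3W , U²+3W²≡k
    ...   | yes U≡3W = 0# , - (2# * W) , 0≢-6W , trans 12W²≡U²+3W² U²+3W²≡k
      where
      open ≡-Reasoning
      12W²≡U²+3W² : 0# * 0# + 3# * (- (2# * W) * - (2# * W)) ≡ U * U + 3# * (W * W)
      12W²≡U²+3W² = begin
        0# * 0# + 3# * (- (2# * W) * - (2# * W))  ≡⟨ solve 1 (λ W → κ 0 :* κ 0 :+ κ 3 :* (:- (κ 2 :* W) :* :- (κ 2 :* W))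
                                                               := κ 3 :* W :* (κ 3 :* W) :+ κ 3 :* (W :* W)) refl W ⟩
        3# * W * (3# * W) + 3# * (W * W)          ≡⟨ cong (λ z → z * z + 3# * (W * W)) U≡3W ⟨
        U * U + 3# * (W * W)                      ∎
      W≢0 : W ≢ 0#
      W≢0 W≡0 = k≢0 (begin
        k                                 ≡⟨ U²+3W²≡k ⟨
        U * U + 3# * (W * W)              ≡⟨ cong₂ (λ u w → u * u + 3# * (w * w)) (trans U≡3W (cong (3# *_) W≡0)) W≡0 ⟩
        3# * 0# * (3# * 0#) + 3# * (0# * 0#) ≡⟨ solve 0 (κ 3 :* κ 0 :* (κ 3 :* κ 0) :+ κ 3 :* (κ 0 :* κ 0) := κ 0) refl ⟩
        0#                                ∎)
      0≢-6W : 0# ≢ 3# * - (2# * W)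
      0≢-6W e = *-≢0 (*-≢0 3≢0 2≢0) W≢0 (begin
        3# * 2# * W               ≡⟨ solve 1 (λ W → κ 3 :* κ 2 :* W := κ 0 :- κ 3 :* :- (κ 2 :* W)) refl W ⟩
        0# - 3# * - (2# * W)      ≡⟨ ≡⇒-≡0 e ⟩
        0#                        ∎)

    -- With X = x + h the cubic is a X³ − a k X + const, so X ≠ Y collide iff
    -- X² + XY + Y² = k; X = U − W, Y = 2W gives X² + XY + Y² = U² + 3W².
    depressed-shape : ∀ a h k → CubicShape a (3# * a * h) (3# * a * (h * h) - a * k)
    depressed-shape a h k with k ≟ 0#
    ... | yes refl = perfectCube (- h)
      (solve 2 (λ a h → κ 3 :* a :* h := :- (κ 3 :* a :* :- h)) refl a h)
      (solve 2 (λ a h → κ 3 :* a :* (h :* h) :- a :* κ 0 := κ 3 :* a :* (:- h :* :- h)) refl a h)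
    ... | no k≢0 with norm-off-diagonal k≢0
    ...   | U , W , U≢3W , refl = collision (U - W - h) (2# * W - h) x≢y
      (solve 4 (λ a h U W → cubic′ a (κ 3 :* a :* h) (κ 3 :* a :* (h :* h) :- a :* (U :* U :+ κ 3 :* (W :* W))) (U :- W :- h)
                         := cubic′ a (κ 3 :* a :* h) (κ 3 :* a :* (h :* h) :- a :* (U :* U :+ κ 3 :* (W :* W))) (κ 2 :* W :- h))
             refl a h U W)
      where
      cubic′ : ∀ {n} → Polynomial n → Polynomial n → Polynomial n → Polynomial n → Polynomial n
      cubic′ a b c x = a :* (x :* x :* x) :+ b :* (x :* x) :+ c :* x
      x≢y : U - W - h ≢ 2# * W - h
      x≢y e = U≢3W (-≡0⇒≡ (trans
        (solve 3 (λ U W h → U :- κ 3 :* W := (U :- W :- h) :- (κ 2 :* W :- h)) refl U W h) (≡⇒-≡0 e)))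

    cubic-shape : ∀ a b c → a ≢ 0# → CubicShape a b c
    cubic-shape a b c a≢0 with inverse a a≢0 | inverse 3# 3≢0
    ... | a⁻¹ , aa⁻¹≡1 | 3⁻¹ , 33⁻¹≡1 =
      subst₂ (CubicShape a) (sym b≡3ah) (sym c≡3ah²-ak) (depressed-shape a h k)
      where
      open ≡-Reasoning
      h k : Carrier
      h = b * a⁻¹ * 3⁻¹
      k = (3# * a * (h * h) - c) * a⁻¹
      b≡3ah : b ≡ 3# * a * h
      b≡3ah = begin
        b                           ≡⟨ solve 1 (λ b → b := b :* κ 1 :* κ 1) refl b ⟩
        b * 1# * 1#                 ≡⟨ cong₂ (λ u v → b * u * v) aa⁻¹≡1 33⁻¹≡1 ⟨
        b * (a * a⁻¹) * (3# * 3⁻¹)  ≡⟨ solve 4 (λ a b a⁻¹ 3⁻¹ → b :* (a :* a⁻¹) :* (κ 3 :* 3⁻¹)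
                                                        := κ 3 :* a :* (b :* a⁻¹ :* 3⁻¹)) refl a b a⁻¹ 3⁻¹ ⟩
        3# * a * h                  ∎
      c≡3ah²-ak : c ≡ 3# * a * (h * h) - a * k
      c≡3ah²-ak = begin
        c                         ≡⟨ solve 2 (λ m c → c := m :- (m :- c) :* κ 1) refl m c ⟩
        m - (m - c) * 1#          ≡⟨ cong (λ z → m - (m - c) * z) aa⁻¹≡1 ⟨
        m - (m - c) * (a * a⁻¹)   ≡⟨ solve 4 (λ m c a a⁻¹ → m :- (m :- c) :* (a :* a⁻¹)
                                                       := m :- a :* ((m :- c) :* a⁻¹)) refl m c a a⁻¹ ⟩
        m - a * k                 ∎
        where
        m : Carrier
        m = 3# * a * (h * h)

module Geometry (F : FiniteField) where
  open FieldTheory F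
  open PG3 F hiding (3#)

  ⟨⟩-cong : ∀ {a b c d a′ b′ c′ d′} → a ≡ a′ → b ≡ b′ → c ≡ c′ → d ≡ d′ →
            ⟨ a , b , c , d ⟩ ≡ ⟨ a′ , b′ , c′ , d′ ⟩
  ⟨⟩-cong refl refl refl refl = refl

  ·-inner : ∀ c v x → inner (c · v) x ≡ c * inner v x
  ·-inner c ⟨ y0 , y1 , y2 , y3 ⟩ ⟨ x0 , x1 , x2 , x3 ⟩ = solve 9 (λ c y0 y1 y2 y3 x0 x1 x2 x3 →
      c :* y0 :* x0 :+ c :* y1 :* x1 :+ c :* y2 :* x2 :+ c :* y3 :* x3
      := c :* (y0 :* x0 :+ y1 :* x1 :+ y2 :* x2 :+ y3 :* x3)) refl c y0 y1 y2 y3 x0 x1 x2 x3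

  inner-· : ∀ v c x → inner v (c · x) ≡ c * inner v x
  inner-· ⟨ y0 , y1 , y2 , y3 ⟩ c ⟨ x0 , x1 , x2 , x3 ⟩ = solve 9 (λ c y0 y1 y2 y3 x0 x1 x2 x3 →
      y0 :* (c :* x0) :+ y1 :* (c :* x1) :+ y2 :* (c :* x2) :+ y3 :* (c :* x3)
      := c :* (y0 :* x0 :+ y1 :* x1 :+ y2 :* x2 :+ y3 :* x3)) refl c y0 y1 y2 y3 x0 x1 x2 x3

  ·-identityˡ : ∀ v → 1# · v ≡ v
  ·-identityˡ ⟨ y0 , y1 , y2 , y3 ⟩ = ⟨⟩-cong (*-identityˡ y0) (*-identityˡ y1) (*-identityˡ y2) (*-identityˡ y3)

  ·-≢zero4 : ∀ {c v} → c ≢ 0# → v ≢ zero4 → c · v ≢ zero4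
  ·-≢zero4 {c} {⟨ y0 , y1 , y2 , y3 ⟩} c≢0 v≢0 cv≡0 = v≢0 (⟨⟩-cong
    (*-cancelˡ-≡0 c≢0 (cong c0 cv≡0)) (*-cancelˡ-≡0 c≢0 (cong c1 cv≡0))
    (*-cancelˡ-≡0 c≢0 (cong c2 cv≡0)) (*-cancelˡ-≡0 c≢0 (cong c3 cv≡0)))

  ·-incident : ∀ c {v x} → inner v x ≡ 0# → inner (c · v) x ≡ 0#
  ·-incident c {v} {x} vx≡0 = trans (·-inner c v x) (trans (cong (c *_) vx≡0) (zeroʳ c))

  ·-incident⁻¹ : ∀ {c v x} → c ≢ 0# → inner (c · v) x ≡ 0# → inner v x ≡ 0#
  ·-incident⁻¹ {c} {v} {x} c≢0 cvx≡0 = *-cancelˡ-≡0 c≢0 (trans (sym (·-inner c v x)) cvx≡0)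

  ·-contains : ∀ c {P Q v} → Contains P Q v → Contains P Q (c · v)
  ·-contains c (vP≡0 , vQ≡0) = ·-incident c vP≡0 , ·-incident c vQ≡0

  ·-contains⁻¹ : ∀ {c P Q v} → c ≢ 0# → Contains P Q (c · v) → Contains P Q v
  ·-contains⁻¹ c≢0 (vP≡0 , vQ≡0) = ·-incident⁻¹ c≢0 vP≡0 , ·-incident⁻¹ c≢0 vQ≡0

  point : Maybe Carrier → V4
  point (just t) = cubicPt t
  point nothing  = P∞

  oscAt : Maybe Carrier → V4
  oscAt (just t) = oscPlane t
  oscAt nothing  = oscPlane∞

  oscPlane-cubicPt : ∀ t x → inner (oscPlane t) (cubicPt x) ≡ (x - t) * (x - t) * (x - t)
  oscPlane-cubicPt t x = solve 2 (λ t x →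
      :- (t :* t :* t) :* κ 1 :+ κ 3 :* (t :* t) :* x :+ :- (κ 3 :* t) :* (x :* x) :+ κ 1 :* (x :* x :* x)
      := (x :- t) :* (x :- t) :* (x :- t)) refl t x

  oscAt-incident : ∀ a b → inner (oscAt a) (point b) ≡ 0# → b ≡ a
  oscAt-incident (just t) (just x) e =
    cong just (-≡0⇒≡ (cube-≡0 (trans (sym (oscPlane-cubicPt t x)) e)))
  oscAt-incident (just t) nothing  e = ⊥-elim (1≢0 (trans
    (solve 1 (λ t → κ 1 := :- (t :* t :* t) :* κ 0 :+ κ 3 :* (t :* t) :* κ 0 :+ :- (κ 3 :* t) :* κ 0 :+ κ 1 :* κ 1) refl t) e))
  oscAt-incident nothing  (just x) e = ⊥-elim (1≢0 (trans
    (solve 1 (λ x → κ 1 := κ 1 :* κ 1 :+ κ 0 :* x :+ κ 0 :* (x :* x) :+ κ 0 :* (x :* x :* x)) refl x) e))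
  oscAt-incident nothing  nothing  e = refl

  oscAt-incident-self : ∀ a → inner (oscAt a) (point a) ≡ 0#
  oscAt-incident-self (just t) = trans (oscPlane-cubicPt t t)
    (solve 1 (λ t → (t :- t) :* (t :- t) :* (t :- t) := κ 0) refl t)
  oscAt-incident-self nothing  = solve 0 (κ 1 :* κ 0 :+ κ 0 :* κ 0 :+ κ 0 :* κ 0 :+ κ 0 :* κ 1 := κ 0) refl

  oscAt-≢zero4 : ∀ a → oscAt a ≢ zero4
  oscAt-≢zero4 (just t) e = 1≢0 (cong c3 e)
  oscAt-≢zero4 nothing  e = 1≢0 (cong c0 e)

  osculating⇒oscAt : ∀ π → Osculating π → ∃₂ λ a c → c ≢ 0# × π ≡ c · oscAt a
  osculating⇒oscAt π (inj₁ at-some-t) with Any.satisfied at-some-t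
  ... | t , proportional with Any.satisfied proportional
  ...   | c , c≢0 , π≡c·osc = just t , c , c≢0 , π≡c·osc
  osculating⇒oscAt π (inj₂ proportional) with Any.satisfied proportional
  ... | c , c≢0 , π≡c·osc = nothing , c , c≢0 , π≡c·osc

  oscAt⇒osculating : ∀ a c → c ≢ 0# → Osculating (c · oscAt a)
  oscAt⇒osculating (just t) c c≢0 =
    inj₁ (Any.map (λ { refl → Any.map (λ { refl → c≢0 , refl }) (complete c) }) (complete t))
  oscAt⇒osculating nothing  c c≢0 = inj₂ (Any.map (λ { refl → c≢0 , refl }) (complete c))

  ∈allV4 : ∀ v → v ∈ allV4
  ∈allV4 ⟨ a , b , c , d ⟩ =
    ∈-concatMap⁺ _ (Any.map (λ { refl →
    ∈-concatMap⁺ _ (Any.map (λ { refl →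
    ∈-concatMap⁺ _ (Any.map (λ { refl →
    ∈-map⁺ _ (complete d) }) (complete c)) }) (complete b)) }) (complete a))

  scale-to-normalized : ∀ v {x} → x ≢ 0# → (∀ y → y * x ≡ 1# → Normalized (y · v)) →
                        ∃ λ y → y ≢ 0# × y · v ∈ planes
  scale-to-normalized v {x} x≢0 normalized with inverse x x≢0
  ... | y , xy≡1 = y , inverse-≢0 xy≡1 ,
    ∈-filter⁺ normalized? (∈allV4 (y · v)) (normalized y (trans (*-comm y x) xy≡1))

  normalize : ∀ v → v ≢ zero4 → ∃ λ c → c ≢ 0# × c · v ∈ planes
  normalize v@(⟨ a , b , c , d ⟩) v≢0 with a ≟ 0# | b ≟ 0# | c ≟ 0# | d ≟ 0#
  ... | no a≢0 | _ | _ | _ = scale-to-normalized v a≢0 λ _ → inj₁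
  ... | yes refl | no b≢0 | _ | _ = scale-to-normalized v b≢0 λ y e →
    inj₂ (zeroʳ y , inj₁ e)
  ... | yes refl | yes refl | no c≢0 | _ = scale-to-normalized v c≢0 λ y e →
    inj₂ (zeroʳ y , inj₂ (zeroʳ y , inj₁ e))
  ... | yes refl | yes refl | yes refl | no d≢0 = scale-to-normalized v d≢0 λ y e →
    inj₂ (zeroʳ y , inj₂ (zeroʳ y , inj₂ (zeroʳ y , e)))
  ... | yes refl | yes refl | yes refl | yes refl = ⊥-elim (v≢0 refl)

  module Roots (y0 y1 y2 y3 : Carrier) where
    y : V4
    y = ⟨ y0 , y1 , y2 , y3 ⟩

    Root : Carrier → Set
    Root t = inner y (cubicPt t) ≡ 0#

    -- Δ₁ and Δ₂ are the first and second divided differences of t ↦ inner y (cubicPt t).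
    private

      Δ₁ : Carrier → Carrier → Carrier
      Δ₁ t₁ t₂ = y1 + y2 * (t₁ + t₂) + y3 * (t₁ * t₁ + t₁ * t₂ + t₂ * t₂)

      Δ₂ : Carrier → Carrier → Carrier → Carrier
      Δ₂ t₁ t₂ t₃ = y2 + y3 * (t₁ + t₂ + t₃)

      Δ₁≡0 : ∀ {t₁ t₂} → t₁ ≢ t₂ → Root t₁ → Root t₂ → Δ₁ t₁ t₂ ≡ 0#
      Δ₁≡0 {t₁} {t₂} t₁≢t₂ r₁ r₂ = *-cancelˡ-≡0 (t₁≢t₂ ∘ -≡0⇒≡) (trans
        (solve 6 (λ y0 y1 y2 y3 t₁ t₂ →
            (t₁ :- t₂) :* (y1 :+ y2 :* (t₁ :+ t₂) :+ y3 :* (t₁ :* t₁ :+ t₁ :* t₂ :+ t₂ :* t₂))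
            := (y0 :* κ 1 :+ y1 :* t₁ :+ y2 :* (t₁ :* t₁) :+ y3 :* (t₁ :* t₁ :* t₁))
            :- (y0 :* κ 1 :+ y1 :* t₂ :+ y2 :* (t₂ :* t₂) :+ y3 :* (t₂ :* t₂ :* t₂))) refl y0 y1 y2 y3 t₁ t₂)
        (≡⇒-≡0 (trans r₁ (sym r₂))))

      Δ₂≡0 : ∀ {t₁ t₂ t₃} → t₂ ≢ t₃ → Δ₁ t₁ t₂ ≡ 0# → Δ₁ t₁ t₃ ≡ 0# → Δ₂ t₁ t₂ t₃ ≡ 0#
      Δ₂≡0 {t₁} {t₂} {t₃} t₂≢t₃ d₂ d₃ = *-cancelˡ-≡0 (t₂≢t₃ ∘ -≡0⇒≡) (trans
        (solve 6 (λ y1 y2 y3 t₁ t₂ t₃ → (t₂ :- t₃) :* (y2 :+ y3 :* (t₁ :+ t₂ :+ t₃))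
            := (y1 :+ y2 :* (t₁ :+ t₂) :+ y3 :* (t₁ :* t₁ :+ t₁ :* t₂ :+ t₂ :* t₂))
            :- (y1 :+ y2 :* (t₁ :+ t₃) :+ y3 :* (t₁ :* t₁ :+ t₁ :* t₃ :+ t₃ :* t₃))) refl y1 y2 y3 t₁ t₂ t₃)
        (≡⇒-≡0 (trans d₂ (sym d₃))))

      y3≡0 : ∀ {t₁ t₂ t₃ t₄} → t₃ ≢ t₄ → Δ₂ t₁ t₂ t₃ ≡ 0# → Δ₂ t₁ t₂ t₄ ≡ 0# → y3 ≡ 0#
      y3≡0 {t₁} {t₂} {t₃} {t₄} t₃≢t₄ d₃ d₄ = *-cancelˡ-≡0 (t₃≢t₄ ∘ -≡0⇒≡) (trans
        (solve 6 (λ y2 y3 t₁ t₂ t₃ t₄ → (t₃ :- t₄) :* y3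
            := (y2 :+ y3 :* (t₁ :+ t₂ :+ t₃)) :- (y2 :+ y3 :* (t₁ :+ t₂ :+ t₄))) refl y2 y3 t₁ t₂ t₃ t₄)
        (≡⇒-≡0 (trans d₃ (sym d₄))))

      strip : ∀ a b s → b ≡ 0# → a + b * s ≡ 0# → a ≡ 0#
      strip a b s refl e = trans (solve 2 (λ a s → a := a :+ κ 0 :* s) refl a s) e

    three-roots : ∀ {t₁ t₂ t₃} → t₁ ≢ t₂ → t₁ ≢ t₃ → t₂ ≢ t₃ → y3 ≡ 0# →
                  Root t₁ → Root t₂ → Root t₃ → y ≡ zero4
    three-roots {t₁} {t₂} {t₃} t₁≢t₂ t₁≢t₃ t₂≢t₃ z3 r₁ r₂ r₃ = ⟨⟩-cong z0 z1 z2 z3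
      where
      d₁₂ : Δ₁ t₁ t₂ ≡ 0#
      d₁₂ = Δ₁≡0 t₁≢t₂ r₁ r₂
      z2 : y2 ≡ 0#
      z2 = strip y2 y3 _ z3 (Δ₂≡0 t₂≢t₃ d₁₂ (Δ₁≡0 t₁≢t₃ r₁ r₃))
      z1 : y1 ≡ 0#
      z1 = strip y1 y2 _ z2 (strip (y1 + y2 * (t₁ + t₂)) y3 _ z3 d₁₂)
      z0 : y0 ≡ 0#
      z0 = trans (sym (*-identityʳ y0))
             (strip (y0 * 1#) y1 t₁ z1 (strip _ y2 _ z2 (strip _ y3 _ z3 r₁)))

    four-roots : ∀ {t₁ t₂ t₃ t₄} → t₁ ≢ t₂ → t₁ ≢ t₃ → t₁ ≢ t₄ → t₂ ≢ t₃ → t₂ ≢ t₄ → t₃ ≢ t₄ →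
                 Root t₁ → Root t₂ → Root t₃ → Root t₄ → y ≡ zero4
    four-roots t₁≢t₂ t₁≢t₃ t₁≢t₄ t₂≢t₃ t₂≢t₄ t₃≢t₄ r₁ r₂ r₃ r₄ =
      three-roots t₁≢t₂ t₁≢t₃ t₂≢t₃
        (y3≡0 t₃≢t₄ (Δ₂≡0 t₂≢t₃ d₁₂ (Δ₁≡0 t₁≢t₃ r₁ r₃)) (Δ₂≡0 t₂≢t₄ d₁₂ (Δ₁≡0 t₁≢t₄ r₁ r₄))) r₁ r₂ r₃
      where
      d₁₂ : Δ₁ _ _ ≡ 0#
      d₁₂ = Δ₁≡0 t₁≢t₂ r₁ r₂

  TwoPoints : V4 → Set
  TwoPoints v = ∃₂ λ a b → a ≢ b × inner v (point a) ≡ 0# × inner v (point b) ≡ 0#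

  roots : V4 → List Carrier
  roots v = filter (λ t → inner v (cubicPt t) ≟ 0#) elems

  ∈roots : ∀ {v} x → inner v (cubicPt x) ≡ 0# → x ∈ roots v
  ∈roots {v} x = ∈-filter⁺ (λ t → inner v (cubicPt t) ≟ 0#) (complete x)

  roots-unique : ∀ v → Unique (roots v)
  roots-unique v = Unique.filter⁺ (λ t → inner v (cubicPt t) ≟ 0#) unique

  roots-incident : ∀ v → All (λ t → inner v (cubicPt t) ≡ 0#) (roots v)
  roots-incident v = All.all-filter (λ t → inner v (cubicPt t) ≟ 0#) elems

  #C∩-on-P∞ : ∀ v → inner v P∞ ≡ 0# → #C∩ v ≡ length (roots v) ℕ.+ 1
  #C∩-on-P∞ v e with inner v P∞ ≟ 0#
  ... | yes _ = refl
  ... | no ¬e = ⊥-elim (¬e e)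

  #C∩≥2 : ∀ v → TwoPoints v → 2 ℕ.≤ #C∩ v
  #C∩≥2 v (just x , just y , x≢y , vx≡0 , vy≡0) = ℕ.≤-trans
    (length≥2 (x≢y ∘ cong just) (∈roots x vx≡0) (∈roots y vy≡0)) (ℕ.m≤m+n (length (roots v)) _)
  #C∩≥2 v (just x , nothing , _ , vx≡0 , v∞≡0) rewrite #C∩-on-P∞ v v∞≡0 =
    ℕ.≤-trans (s≤s (length≥1 (∈roots x vx≡0))) (ℕ.≤-reflexive (ℕ.+-comm 1 _))
  #C∩≥2 v (nothing , just y , _ , v∞≡0 , vy≡0) rewrite #C∩-on-P∞ v v∞≡0 =
    ℕ.≤-trans (s≤s (length≥1 (∈roots y vy≡0))) (ℕ.≤-reflexive (ℕ.+-comm 1 _))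
  #C∩≥2 v (nothing , nothing , a≢b , _) = ⊥-elim (a≢b refl)

  #C∩≤3 : ∀ v → v ≢ zero4 → #C∩ v ℕ.≤ 3
  #C∩≤3 v@(⟨ y0 , y1 , y2 , y3 ⟩) v≢0 with inner v P∞ ≟ 0#
  ... | yes v∞≡0 = ℕ.≤-trans (ℕ.≤-reflexive (ℕ.+-comm (length (roots v)) 1))
    (s≤s (length≤2 (roots-unique v) (roots-incident v) λ a≢b a≢c b≢c ra rb rc →
      v≢0 (Roots.three-roots y0 y1 y2 y3 a≢b a≢c b≢c (trans y3≡inner-P∞ v∞≡0) ra rb rc)))
    where
    y3≡inner-P∞ : y3 ≡ inner v P∞
    y3≡inner-P∞ = solve 4 (λ y0 y1 y2 y3 → y3 := y0 :* κ 0 :+ y1 :* κ 0 :+ y2 :* κ 0 :+ y3 :* κ 1) refl y0 y1 y2 y3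
  ... | no _ = ℕ.≤-trans (ℕ.≤-reflexive (ℕ.+-identityʳ (length (roots v))))
    (length≤3 (roots-unique v) (roots-incident v) λ a≢b a≢c a≢d b≢c b≢d c≢d ra rb rc rd →
      v≢0 (Roots.four-roots y0 y1 y2 y3 a≢b a≢c a≢d b≢c b≢d c≢d ra rb rc rd))

  ·-TwoPoints : ∀ c {v} → TwoPoints v → TwoPoints (c · v)
  ·-TwoPoints c (a , b , a≢b , va≡0 , vb≡0) = a , b , a≢b , ·-incident c va≡0 , ·-incident c vb≡0

  oscAt-¬TwoPoints : ∀ {c} a → c ≢ 0# → ¬ TwoPoints (c · oscAt a)
  oscAt-¬TwoPoints a c≢0 (b₁ , b₂ , b₁≢b₂ , e₁ , e₂) = b₁≢b₂ (trans
    (oscAt-incident a b₁ (·-incident⁻¹ c≢0 e₁)) (sym (oscAt-incident a b₂ (·-incident⁻¹ c≢0 e₂))))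

  secant-class : ∀ w → w ≢ zero4 → TwoPoints w → H2 w ⊎ H3 w
  secant-class w w≢0 two with osculating? w
  ... | yes w-osculating with osculating⇒oscAt w w-osculating
  ...   | a , c , c≢0 , refl = ⊥-elim (oscAt-¬TwoPoints a c≢0 two)
  secant-class w w≢0 two | no ¬w-osculating with #C∩ w | #C∩≥2 w two | #C∩≤3 w w≢0
  ... | 2 | _ | _ = inj₁ (¬w-osculating , refl)
  ... | 3 | _ | _ = inj₂ refl
  ... | 1 | s≤s () | _
  ... | suc (suc (suc (suc _))) | _ | s≤s (s≤s (s≤s ()))

  data SecantOrOsculating (a : Maybe Carrier) (P Q : V4) : Set where
    secant     : ∀ v → v ≢ zero4 → Contains P Q v → TwoPoints v → SecantOrOsculating a P Q
    osculating : ∀ b → b ≢ a → Contains P Q (oscAt b) → SecantOrOsculating a P Q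

  -- A collineation preserving C, acting on points by act and on planes by its transpose
  -- coact; param is the inverse of the permutation it induces on C.
  record Symmetry : Set where
    field
      act             : V4 → V4
      coact           : V4 → V4
      adjoint         : ∀ v x → inner (coact v) x ≡ inner v (act x)
      act-linear      : ∀ a b x y → act ((a · x) ⊕ (b · y)) ≡ (a · act x) ⊕ (b · act y)
      act-injective   : ∀ {x} → act x ≡ zero4 → x ≡ zero4
      coact-injective : ∀ {v} → coact v ≡ zero4 → v ≡ zero4
      param           : Maybe Carrier → Maybe Carrier
      param-injective : ∀ {a b} → param a ≡ param b → a ≡ b
      act-point       : ∀ a → ∃ λ c → act (point (param a)) ≡ c · point a
      coact-oscAt     : ∀ a → ∃ λ c → c ≢ 0# × coact (oscAt a) ≡ c · oscAt (param a)

  module _ (σ : Symmetry) where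
    open Symmetry σ

    coact-contains : ∀ {P Q v} → Contains (act P) (act Q) v → Contains P Q (coact v)
    coact-contains {P} {Q} {v} (vP≡0 , vQ≡0) = trans (adjoint v P) vP≡0 , trans (adjoint v Q) vQ≡0

    act-contains-oscAt : ∀ {P Q} a → Contains P Q (oscAt (param a)) → Contains (act P) (act Q) (oscAt a)
    act-contains-oscAt {P} {Q} a contains with coact-oscAt a
    ... | c , _ , coact≡ = incident P (proj₁ contains) , incident Q (proj₂ contains)
      where
      incident : ∀ x → inner (oscAt (param a)) x ≡ 0# → inner (oscAt a) (act x) ≡ 0#
      incident x e = trans (sym (adjoint (oscAt a) x)) (subst (λ w → inner w x ≡ 0#) (sym coact≡) (·-incident c e))

    act-independent : ∀ {P Q} → Independent P Q → Independent (act P) (act Q)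
    act-independent {P} {Q} indep a b e = indep a b (act-injective (trans (act-linear a b P Q) e))

    coact-TwoPoints : ∀ {v} → TwoPoints v → TwoPoints (coact v)
    coact-TwoPoints {v} (a , b , a≢b , va≡0 , vb≡0) =
      param a , param b , a≢b ∘ param-injective , incident a va≡0 , incident b vb≡0
      where
      incident : ∀ a → inner v (point a) ≡ 0# → inner (coact v) (point (param a)) ≡ 0#
      incident a e with act-point a
      ... | c , act≡ = begin
        inner (coact v) (point (param a))  ≡⟨ adjoint v _ ⟩
        inner v (act (point (param a)))    ≡⟨ cong (inner v) act≡ ⟩
        inner v (c · point a)              ≡⟨ inner-· v c (point a) ⟩
        c * inner v (point a)              ≡⟨ cong (c *_) e ⟩
        c * 0#                             ≡⟨ zeroʳ c ⟩
        0#                                 ∎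
        where open ≡-Reasoning

    transport : ∀ {a P Q} → SecantOrOsculating a (act P) (act Q) → SecantOrOsculating (param a) P Q
    transport (secant v v≢0 contains two) =
      secant (coact v) (v≢0 ∘ coact-injective) (coact-contains contains) (coact-TwoPoints two)
    transport (osculating b b≢a contains) with coact-oscAt b
    ... | c , c≢0 , coact≡ = osculating (param b) (b≢a ∘ param-injective)
      (·-contains⁻¹ c≢0 (subst (Contains _ _) coact≡ (coact-contains contains)))

  shift : Carrier → V4 → V4
  shift s ⟨ x0 , x1 , x2 , x3 ⟩ =
    ⟨ x0 , x1 - s * x0 , x2 - 2# * s * x1 + s * s * x0 , x3 - 3# * s * x2 + 3# * s * s * x1 - s * s * s * x0 ⟩

  shiftᵀ : Carrier → V4 → V4
  shiftᵀ s ⟨ y0 , y1 , y2 , y3 ⟩ =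
    ⟨ y0 - s * y1 + s * s * y2 - s * s * s * y3 , y1 - 2# * s * y2 + 3# * s * s * y3 , y2 - 3# * s * y3 , y3 ⟩

  shift-inverse : ∀ s x → shift (- s) (shift s x) ≡ x
  shift-inverse s ⟨ x0 , x1 , x2 , x3 ⟩ = ⟨⟩-cong refl
    (solve 3 (λ s x0 x1 → x1 :- s :* x0 :- :- s :* x0 := x1) refl s x0 x1)
    (solve 4 (λ s x0 x1 x2 → x2 :- κ 2 :* s :* x1 :+ s :* s :* x0 :- κ 2 :* :- s :* (x1 :- s :* x0) :+ :- s :* :- s :* x0
                             := x2) refl s x0 x1 x2)
    (solve 5 (λ s x0 x1 x2 x3 →
       x3 :- κ 3 :* s :* x2 :+ κ 3 :* s :* s :* x1 :- s :* s :* s :* x0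
       :- κ 3 :* :- s :* (x2 :- κ 2 :* s :* x1 :+ s :* s :* x0) :+ κ 3 :* :- s :* :- s :* (x1 :- s :* x0)
       :- :- s :* :- s :* :- s :* x0 := x3) refl s x0 x1 x2 x3)

  shiftᵀ-inverse : ∀ s y → shiftᵀ (- s) (shiftᵀ s y) ≡ y
  shiftᵀ-inverse s ⟨ y0 , y1 , y2 , y3 ⟩ = ⟨⟩-cong
    (solve 5 (λ s y0 y1 y2 y3 →
       y0 :- s :* y1 :+ s :* s :* y2 :- s :* s :* s :* y3
       :- :- s :* (y1 :- κ 2 :* s :* y2 :+ κ 3 :* s :* s :* y3) :+ :- s :* :- s :* (y2 :- κ 3 :* s :* y3)
       :- :- s :* :- s :* :- s :* y3 := y0) refl s y0 y1 y2 y3)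
    (solve 4 (λ s y1 y2 y3 → y1 :- κ 2 :* s :* y2 :+ κ 3 :* s :* s :* y3 :- κ 2 :* :- s :* (y2 :- κ 3 :* s :* y3)
                             :+ κ 3 :* :- s :* :- s :* y3 := y1) refl s y1 y2 y3)
    (solve 3 (λ s y2 y3 → y2 :- κ 3 :* s :* y3 :- κ 3 :* :- s :* y3 := y2) refl s y2 y3)
    refl

  shift-zero4 : ∀ s → shift s zero4 ≡ zero4
  shift-zero4 s = ⟨⟩-cong refl
    (solve 1 (λ s → κ 0 :- s :* κ 0 := κ 0) refl s)
    (solve 1 (λ s → κ 0 :- κ 2 :* s :* κ 0 :+ s :* s :* κ 0 := κ 0) refl s)
    (solve 1 (λ s → κ 0 :- κ 3 :* s :* κ 0 :+ κ 3 :* s :* s :* κ 0 :- s :* s :* s :* κ 0 := κ 0) refl s)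

  shiftᵀ-zero4 : ∀ s → shiftᵀ s zero4 ≡ zero4
  shiftᵀ-zero4 s = ⟨⟩-cong
    (solve 1 (λ s → κ 0 :- s :* κ 0 :+ s :* s :* κ 0 :- s :* s :* s :* κ 0 := κ 0) refl s)
    (solve 1 (λ s → κ 0 :- κ 2 :* s :* κ 0 :+ κ 3 :* s :* s :* κ 0 := κ 0) refl s)
    (solve 1 (λ s → κ 0 :- κ 3 :* s :* κ 0 := κ 0) refl s)
    refl

  shift-adjoint : ∀ s y x → inner (shiftᵀ s y) x ≡ inner y (shift s x)
  shift-adjoint s ⟨ y0 , y1 , y2 , y3 ⟩ ⟨ x0 , x1 , x2 , x3 ⟩ = solve 9 (λ s y0 y1 y2 y3 x0 x1 x2 x3 →
     (y0 :- s :* y1 :+ s :* s :* y2 :- s :* s :* s :* y3) :* x0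
     :+ (y1 :- κ 2 :* s :* y2 :+ κ 3 :* s :* s :* y3) :* x1
     :+ (y2 :- κ 3 :* s :* y3) :* x2 :+ y3 :* x3
     := y0 :* x0 :+ y1 :* (x1 :- s :* x0) :+ y2 :* (x2 :- κ 2 :* s :* x1 :+ s :* s :* x0)
        :+ y3 :* (x3 :- κ 3 :* s :* x2 :+ κ 3 :* s :* s :* x1 :- s :* s :* s :* x0))
     refl s y0 y1 y2 y3 x0 x1 x2 x3

  shift-linear : ∀ s a b x y → shift s ((a · x) ⊕ (b · y)) ≡ (a · shift s x) ⊕ (b · shift s y)
  shift-linear s a b ⟨ p0 , p1 , p2 , p3 ⟩ ⟨ q0 , q1 , q2 , q3 ⟩ = ⟨⟩-cong refl
    (solve 7 (λ s a b p0 p1 q0 q1 → a :* p1 :+ b :* q1 :- s :* (a :* p0 :+ b :* q0)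
        := a :* (p1 :- s :* p0) :+ b :* (q1 :- s :* q0)) refl s a b p0 p1 q0 q1)
    (solve 9 (λ s a b p0 p1 p2 q0 q1 q2 →
        a :* p2 :+ b :* q2 :- κ 2 :* s :* (a :* p1 :+ b :* q1) :+ s :* s :* (a :* p0 :+ b :* q0)
        := a :* (p2 :- κ 2 :* s :* p1 :+ s :* s :* p0) :+ b :* (q2 :- κ 2 :* s :* q1 :+ s :* s :* q0))
        refl s a b p0 p1 p2 q0 q1 q2)
    (solve 11 (λ s a b p0 p1 p2 p3 q0 q1 q2 q3 →
        a :* p3 :+ b :* q3 :- κ 3 :* s :* (a :* p2 :+ b :* q2) :+ κ 3 :* s :* s :* (a :* p1 :+ b :* q1)
          :- s :* s :* s :* (a :* p0 :+ b :* q0)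
        := a :* (p3 :- κ 3 :* s :* p2 :+ κ 3 :* s :* s :* p1 :- s :* s :* s :* p0)
           :+ b :* (q3 :- κ 3 :* s :* q2 :+ κ 3 :* s :* s :* q1 :- s :* s :* s :* q0))
        refl s a b p0 p1 p2 p3 q0 q1 q2 q3)

  shift-cubicPt : ∀ s u → shift s (cubicPt (u + s)) ≡ cubicPt u
  shift-cubicPt s u = ⟨⟩-cong refl
    (solve 2 (λ s u → (u :+ s) :- s :* κ 1 := u) refl s u)
    (solve 2 (λ s u → (u :+ s) :* (u :+ s) :- κ 2 :* s :* (u :+ s) :+ s :* s :* κ 1 := u :* u) refl s u)
    (solve 2 (λ s u → (u :+ s) :* (u :+ s) :* (u :+ s) :- κ 3 :* s :* ((u :+ s) :* (u :+ s))
                      :+ κ 3 :* s :* s :* (u :+ s) :- s :* s :* s :* κ 1 := u :* u :* u) refl s u)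

  shift-P∞ : ∀ s → shift s P∞ ≡ P∞
  shift-P∞ s = ⟨⟩-cong refl
    (solve 1 (λ s → κ 0 :- s :* κ 0 := κ 0) refl s)
    (solve 1 (λ s → κ 0 :- κ 2 :* s :* κ 0 :+ s :* s :* κ 0 := κ 0) refl s)
    (solve 1 (λ s → κ 1 :- κ 3 :* s :* κ 0 :+ κ 3 :* s :* s :* κ 0 :- s :* s :* s :* κ 0 := κ 1) refl s)

  shiftᵀ-oscPlane : ∀ s u → shiftᵀ s (oscPlane u) ≡ oscPlane (u + s)
  shiftᵀ-oscPlane s u = ⟨⟩-cong
    (solve 2 (λ s u → :- (u :* u :* u) :- s :* (κ 3 :* (u :* u)) :+ s :* s :* :- (κ 3 :* u) :- s :* s :* s :* κ 1
                      := :- ((u :+ s) :* (u :+ s) :* (u :+ s))) refl s u)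
    (solve 2 (λ s u → κ 3 :* (u :* u) :- κ 2 :* s :* :- (κ 3 :* u) :+ κ 3 :* s :* s :* κ 1
                      := κ 3 :* ((u :+ s) :* (u :+ s))) refl s u)
    (solve 2 (λ s u → :- (κ 3 :* u) :- κ 3 :* s :* κ 1 := :- (κ 3 :* (u :+ s))) refl s u)
    refl

  shiftᵀ-oscPlane∞ : ∀ s → shiftᵀ s oscPlane∞ ≡ oscPlane∞
  shiftᵀ-oscPlane∞ s = ⟨⟩-cong
    (solve 1 (λ s → κ 1 :- s :* κ 0 :+ s :* s :* κ 0 :- s :* s :* s :* κ 0 := κ 1) refl s)
    (solve 1 (λ s → κ 0 :- κ 2 :* s :* κ 0 :+ κ 3 :* s :* s :* κ 0 := κ 0) refl s)
    (solve 1 (λ s → κ 0 :- κ 3 :* s :* κ 0 := κ 0) refl s)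
    refl

  translation : Carrier → Symmetry
  translation s = record
    { act             = shift s
    ; coact           = shiftᵀ s
    ; adjoint         = shift-adjoint s
    ; act-linear      = shift-linear s
    ; act-injective   = λ {x} e → trans (sym (shift-inverse s x)) (trans (cong (shift (- s)) e) (shift-zero4 (- s)))
    ; coact-injective = λ {v} e → trans (sym (shiftᵀ-inverse s v)) (trans (cong (shiftᵀ (- s)) e) (shiftᵀ-zero4 (- s)))
    ; param           = Data.Maybe.map (_+ s)
    ; param-injective = param-injective
    ; act-point       = λ where
        (just u) → 1# , trans (shift-cubicPt s u) (sym (·-identityˡ _))
        nothing  → 1# , trans (shift-P∞ s) (sym (·-identityˡ _))
    ; coact-oscAt     = λ where
        (just u) → 1# , 1≢0 , trans (shiftᵀ-oscPlane s u) (sym (·-identityˡ _))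
        nothing  → 1# , 1≢0 , trans (shiftᵀ-oscPlane∞ s) (sym (·-identityˡ _))
    }
    where
    param-injective : ∀ {a b} → Data.Maybe.map (_+ s) a ≡ Data.Maybe.map (_+ s) b → a ≡ b
    param-injective {nothing} {nothing} _ = refl
    param-injective {just u}  {just v}  e = cong just (-≡0⇒≡ (trans
      (solve 3 (λ s u v → u :- v := (u :+ s) :- (v :+ s)) refl s u v) (≡⇒-≡0 (Maybe.just-injective e))))

  reverse : V4 → V4
  reverse ⟨ x0 , x1 , x2 , x3 ⟩ = ⟨ x3 , x2 , x1 , x0 ⟩

  reverse-adjoint : ∀ y x → inner (reverse y) x ≡ inner y (reverse x)
  reverse-adjoint ⟨ y0 , y1 , y2 , y3 ⟩ ⟨ x0 , x1 , x2 , x3 ⟩ = solve 8 (λ y0 y1 y2 y3 x0 x1 x2 x3 →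
    y3 :* x0 :+ y2 :* x1 :+ y1 :* x2 :+ y0 :* x3 := y0 :* x3 :+ y1 :* x2 :+ y2 :* x1 :+ y3 :* x0)
    refl y0 y1 y2 y3 x0 x1 x2 x3

  reverse-injective : ∀ {x} → reverse x ≡ zero4 → x ≡ zero4
  reverse-injective {⟨ _ , _ , _ , _ ⟩} e = ⟨⟩-cong (cong c3 e) (cong c2 e) (cong c1 e) (cong c0 e)

  ≡-via : ∀ {x y w} (f : Carrier → Carrier) → w ≡ 1# → x ≡ f 1# → y ≡ f w → x ≡ y
  ≡-via f w≡1 x≡ y≡ = trans x≡ (trans (cong f (sym w≡1)) (sym y≡))

  reverse-cubicPt : ∀ {u ι} → u * ι ≡ 1# → reverse (cubicPt ι) ≡ (ι * ι * ι) · cubicPt u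
  reverse-cubicPt {u} {ι} uι≡1 = ⟨⟩-cong
    (sym (*-identityʳ _))
    (≡-via (λ w → ι * ι * w) uι≡1 (solve 1 (λ ι → ι :* ι := ι :* ι :* κ 1) refl ι)
      (solve 2 (λ ι u → ι :* ι :* ι :* u := ι :* ι :* (u :* ι)) refl ι u))
    (≡-via (λ w → ι * (w * w)) uι≡1 (solve 1 (λ ι → ι := ι :* (κ 1 :* κ 1)) refl ι)
      (solve 2 (λ ι u → ι :* ι :* ι :* (u :* u) := ι :* (u :* ι :* (u :* ι))) refl ι u))
    (≡-via (λ w → w * w * w) uι≡1 (solve 0 (κ 1 := κ 1 :* κ 1 :* κ 1) refl)
      (solve 2 (λ ι u → ι :* ι :* ι :* (u :* u :* u) := u :* ι :* (u :* ι) :* (u :* ι)) refl ι u))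

  reverse-oscPlane : ∀ {u ι} → u * ι ≡ 1# → reverse (oscPlane u) ≡ (- (u * u * u)) · oscPlane ι
  reverse-oscPlane {u} {ι} uι≡1 = ⟨⟩-cong
    (≡-via (λ w → w * w * w) uι≡1 (solve 0 (κ 1 := κ 1 :* κ 1 :* κ 1) refl)
      (solve 2 (λ ι u → :- (u :* u :* u) :* :- (ι :* ι :* ι) := u :* ι :* (u :* ι) :* (u :* ι)) refl ι u))
    (≡-via (λ w → - (3# * u * (w * w))) uι≡1 (solve 1 (λ u → :- (κ 3 :* u) := :- (κ 3 :* u :* (κ 1 :* κ 1))) refl u)
      (solve 2 (λ ι u → :- (u :* u :* u) :* (κ 3 :* (ι :* ι)) := :- (κ 3 :* u :* (u :* ι :* (u :* ι)))) refl ι u))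
    (≡-via (λ w → 3# * (u * u) * w) uι≡1 (solve 1 (λ u → κ 3 :* (u :* u) := κ 3 :* (u :* u) :* κ 1) refl u)
      (solve 2 (λ ι u → :- (u :* u :* u) :* :- (κ 3 :* ι) := κ 3 :* (u :* u) :* (u :* ι)) refl ι u))
    (sym (*-identityʳ _))

  invert : Maybe Carrier → Maybe Carrier
  invert nothing  = just 0#
  invert (just u) with u ≟ 0#
  ... | yes _   = nothing
  ... | no u≢0 = just (proj₁ (inverse u u≢0))

  invert-injective : ∀ {a b} → invert a ≡ invert b → a ≡ b
  invert-injective {nothing} {nothing} _ = refl
  invert-injective {nothing} {just v} e with v ≟ 0#
  ... | no v≢0 = ⊥-elim (inverse-≢0 (proj₂ (inverse v v≢0)) (sym (Maybe.just-injective e)))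
  invert-injective {just u} {nothing} e with u ≟ 0#
  ... | no u≢0 = ⊥-elim (inverse-≢0 (proj₂ (inverse u u≢0)) (Maybe.just-injective e))
  invert-injective {just u} {just v} e with u ≟ 0# | v ≟ 0#
  ... | yes u≡0 | yes v≡0 = cong just (trans u≡0 (sym v≡0))
  ... | no u≢0  | no v≢0 with inverse u u≢0 | inverse v v≢0
  ...   | u⁻¹ , uu⁻¹≡1 | v⁻¹ , vv⁻¹≡1 = cong just (begin
    u                                   ≡⟨ solve 3 (λ u v v⁻¹ → u := u :* (v :* v⁻¹) :+ u :* (κ 1 :- v :* v⁻¹))
                                                 refl u v v⁻¹ ⟩
    u * (v * v⁻¹) + u * (1# - v * v⁻¹)  ≡⟨ cong (λ w → u * (v * w) + u * (1# - v * v⁻¹)) (sym (Maybe.just-injective e)) ⟩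
    u * (v * u⁻¹) + u * (1# - v * v⁻¹)  ≡⟨ cong₂ (λ x y → x + u * (1# - y))
                                             (solve 3 (λ u v u⁻¹ → u :* (v :* u⁻¹) := v :* (u :* u⁻¹)) refl u v u⁻¹) vv⁻¹≡1 ⟩
    v * (u * u⁻¹) + u * (1# - 1#)       ≡⟨ cong (λ w → v * w + u * (1# - 1#)) uu⁻¹≡1 ⟩
    v * 1# + u * (1# - 1#)              ≡⟨ solve 2 (λ u v → v :* κ 1 :+ u :* (κ 1 :- κ 1) := v) refl u v ⟩
    v                                   ∎)
    where open ≡-Reasoning

  reversal : Symmetry
  reversal = record
    { act             = reverse
    ; coact           = reverse
    ; adjoint         = reverse-adjoint
    ; act-linear      = λ _ _ _ _ → refl
    ; act-injective   = reverse-injective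
    ; coact-injective = reverse-injective
    ; param           = invert
    ; param-injective = invert-injective
    ; act-point       = act-point
    ; coact-oscAt     = coact-oscAt
    }
    where
    act-point : ∀ a → ∃ λ c → reverse (point (invert a)) ≡ c · point a
    act-point nothing = 1# , ⟨⟩-cong
      (solve 0 (κ 0 :* κ 0 :* κ 0 := κ 1 :* κ 0) refl) (solve 0 (κ 0 :* κ 0 := κ 1 :* κ 0) refl)
      (solve 0 (κ 0 := κ 1 :* κ 0) refl) (solve 0 (κ 1 := κ 1 :* κ 1) refl)
    act-point (just u) with u ≟ 0#
    ... | yes refl = 1# , ⟨⟩-cong
      (solve 0 (κ 1 := κ 1 :* κ 1) refl) (solve 0 (κ 0 := κ 1 :* κ 0) refl)
      (solve 0 (κ 0 := κ 1 :* (κ 0 :* κ 0)) refl) (solve 0 (κ 0 := κ 1 :* (κ 0 :* κ 0 :* κ 0)) refl)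
    ... | no u≢0 = _ , reverse-cubicPt (proj₂ (inverse u u≢0))

    coact-oscAt : ∀ a → ∃ λ c → c ≢ 0# × reverse (oscAt a) ≡ c · oscAt (invert a)
    coact-oscAt nothing = 1# , 1≢0 , ⟨⟩-cong
      (solve 0 (κ 0 := κ 1 :* :- (κ 0 :* κ 0 :* κ 0)) refl) (solve 0 (κ 0 := κ 1 :* (κ 3 :* (κ 0 :* κ 0))) refl)
      (solve 0 (κ 0 := κ 1 :* :- (κ 3 :* κ 0)) refl) (solve 0 (κ 1 := κ 1 :* κ 1) refl)
    coact-oscAt (just u) with u ≟ 0#
    ... | yes refl = 1# , 1≢0 , ⟨⟩-cong
      (solve 0 (κ 1 := κ 1 :* κ 1) refl) (solve 0 (:- (κ 3 :* κ 0) := κ 1 :* κ 0) refl)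
      (solve 0 (κ 3 :* (κ 0 :* κ 0) := κ 1 :* κ 0) refl) (solve 0 (:- (κ 0 :* κ 0 :* κ 0) := κ 1 :* κ 0) refl)
    ... | no u≢0 = _ , *-≢0 (*-≢0 u≢0 u≢0) u≢0 ∘ -‿≡0⇒≡0 , reverse-oscPlane (proj₂ (inverse u u≢0))

  oscPlane∞-inner : ∀ x → inner oscPlane∞ x ≡ c0 x
  oscPlane∞-inner ⟨ x0 , x1 , x2 , x3 ⟩ =
    solve 4 (λ x0 x1 x2 x3 → κ 1 :* x0 :+ κ 0 :* x1 :+ κ 0 :* x2 :+ κ 0 :* x3 := x0) refl x0 x1 x2 x3

  perfectCube-plane : ∀ a b c τ → b ≡ - (3# * a * τ) → c ≡ 3# * a * (τ * τ) →
                      ⟨ - cubic a b c τ , c , b , a ⟩ ≡ a · oscPlane τ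
  perfectCube-plane a _ _ τ refl refl = ⟨⟩-cong
    (solve 2 (λ a τ → :- (a :* (τ :* τ :* τ) :+ :- (κ 3 :* a :* τ) :* (τ :* τ) :+ κ 3 :* a :* (τ :* τ) :* τ)
                      := a :* :- (τ :* τ :* τ)) refl a τ)
    (solve 2 (λ a τ → κ 3 :* a :* (τ :* τ) := a :* (κ 3 :* (τ :* τ))) refl a τ)
    (solve 2 (λ a τ → :- (κ 3 :* a :* τ) := a :* :- (κ 3 :* τ)) refl a τ)
    (sym (*-identityʳ a))

  module _ {p1 p2 p3 q1 q2 q3 : Carrier} where
    private
      P Q : V4
      P = ⟨ 0# , p1 , p2 , p3 ⟩
      Q = ⟨ 0# , q1 , q2 , q3 ⟩

    -- A vanishing cross product gives q_i P − p_i Q = 0 for i = 1, 2, 3, forcing P = 0.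
    cross-product-≢0 : Independent P Q →
      ¬ (p2 * q3 - p3 * q2 ≡ 0# × p3 * q1 - p1 * q3 ≡ 0# × p1 * q2 - p2 * q1 ≡ 0#)
    cross-product-≢0 indep (n1≡0 , n2≡0 , n3≡0) with p1 ≟ 0# | p2 ≟ 0# | p3 ≟ 0#
    ... | no p1≢0 | _ | _ = p1≢0 (-‿≡0⇒≡0 (proj₂ (indep q1 (- p1) (⟨⟩-cong
      (solve 2 (λ p1 q1 → q1 :* κ 0 :+ :- p1 :* κ 0 := κ 0) refl p1 q1)
      (solve 2 (λ p1 q1 → q1 :* p1 :+ :- p1 :* q1 := κ 0) refl p1 q1)
      (trans (solve 4 (λ p1 p2 q1 q2 → q1 :* p2 :+ :- p1 :* q2 := :- (p1 :* q2 :- p2 :* q1)) refl p1 p2 q1 q2) (≡0⇒-‿≡0 n3≡0))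
      (trans (solve 4 (λ p1 p3 q1 q3 → q1 :* p3 :+ :- p1 :* q3 := p3 :* q1 :- p1 :* q3) refl p1 p3 q1 q3) n2≡0)))))
    ... | yes refl | no p2≢0 | _ = p2≢0 (-‿≡0⇒≡0 (proj₂ (indep q2 (- p2) (⟨⟩-cong
      (solve 2 (λ p2 q2 → q2 :* κ 0 :+ :- p2 :* κ 0 := κ 0) refl p2 q2)
      (trans (solve 3 (λ p2 q1 q2 → q2 :* κ 0 :+ :- p2 :* q1 := κ 0 :* q2 :- p2 :* q1) refl p2 q1 q2) n3≡0)
      (solve 2 (λ p2 q2 → q2 :* p2 :+ :- p2 :* q2 := κ 0) refl p2 q2)
      (trans (solve 4 (λ p2 p3 q2 q3 → q2 :* p3 :+ :- p2 :* q3 := :- (p2 :* q3 :- p3 :* q2)) refl p2 p3 q2 q3) (≡0⇒-‿≡0 n1≡0))))))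
    ... | yes refl | yes refl | no p3≢0 = p3≢0 (-‿≡0⇒≡0 (proj₂ (indep q3 (- p3) (⟨⟩-cong
      (solve 2 (λ p3 q3 → q3 :* κ 0 :+ :- p3 :* κ 0 := κ 0) refl p3 q3)
      (trans (solve 3 (λ p3 q1 q3 → q3 :* κ 0 :+ :- p3 :* q1 := :- (p3 :* q1 :- κ 0 :* q3)) refl p3 q1 q3) (≡0⇒-‿≡0 n2≡0))
      (trans (solve 3 (λ p3 q2 q3 → q3 :* κ 0 :+ :- p3 :* q2 := κ 0 :* q3 :- p3 :* q2) refl p3 q2 q3) n1≡0)
      (solve 2 (λ p3 q3 → q3 :* p3 :+ :- p3 :* q3 := κ 0) refl p3 q3)))))
    ... | yes refl | yes refl | yes refl = 1≢0 (proj₁ (indep 1# 0# (⟨⟩-cong (z 0#) (z q1) (z q2) (z q3))))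
      where
      z : ∀ q → 1# * 0# + 0# * q ≡ 0#
      z = solve 1 (λ q → κ 1 :* κ 0 :+ κ 0 :* q := κ 0) refl

  module _ (2≢0 : 2# ≢ 0#) (3≢0 : 3# ≢ 0#) where

    module _ {p1 p2 p3 q1 q2 q3 : Carrier} (indep : Independent ⟨ 0# , p1 , p2 , p3 ⟩ ⟨ 0# , q1 , q2 , q3 ⟩) where
      private
        P Q : V4
        P = ⟨ 0# , p1 , p2 , p3 ⟩
        Q = ⟨ 0# , q1 , q2 , q3 ⟩
        n1 n2 n3 : Carrier
        n1 = p2 * q3 - p3 * q2
        n2 = p3 * q1 - p1 * q3
        n3 = p1 * q2 - p2 * q1

        V : Carrier → V4
        V l = ⟨ l , n1 , n2 , n3 ⟩

        V-contains : ∀ l → Contains P Q (V l)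
        V-contains l =
          solve 7 (λ l p1 p2 p3 q1 q2 q3 →
            l :* κ 0 :+ (p2 :* q3 :- p3 :* q2) :* p1 :+ (p3 :* q1 :- p1 :* q3) :* p2 :+ (p1 :* q2 :- p2 :* q1) :* p3
            := κ 0) refl l p1 p2 p3 q1 q2 q3 ,
          solve 7 (λ l p1 p2 p3 q1 q2 q3 →
            l :* κ 0 :+ (p2 :* q3 :- p3 :* q2) :* q1 :+ (p3 :* q1 :- p1 :* q3) :* q2 :+ (p1 :* q2 :- p2 :* q1) :* q3
            := κ 0) refl l p1 p2 p3 q1 q2 q3

        V-≢zero4 : ∀ l → V l ≢ zero4
        V-≢zero4 l Vl≡0 = cross-product-≢0 indep (cong c1 Vl≡0 , cong c2 Vl≡0 , cong c3 Vl≡0)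

        V-cubicPt : ∀ l t → inner (V l) (cubicPt t) ≡ l + cubic n3 n2 n1 t
        V-cubicPt l t = solve 5 (λ l n1 n2 n3 t →
          l :* κ 1 :+ n1 :* t :+ n2 :* (t :* t) :+ n3 :* (t :* t :* t)
          := l :+ (n3 :* (t :* t :* t) :+ n2 :* (t :* t) :+ n1 :* t)) refl l n1 n2 n3 t

        V-P∞ : ∀ l → inner (V l) P∞ ≡ n3
        V-P∞ l = solve 4 (λ l n1 n2 n3 → l :* κ 0 :+ n1 :* κ 0 :+ n2 :* κ 0 :+ n3 :* κ 1 := n3) refl l n1 n2 n3

        V-on-cubicPt : ∀ t → inner (V (- cubic n3 n2 n1 t)) (cubicPt t) ≡ 0#
        V-on-cubicPt t = trans (V-cubicPt _ t) (trans (+-comm _ _) (-‿inverseʳ _))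

        from-shape : n3 ≢ 0# → CubicShape n3 n2 n1 → SecantOrOsculating nothing P Q
        from-shape _ (collision x y x≢y e) =
          secant (V l) (V-≢zero4 l) (V-contains l)
            (just x , just y , x≢y ∘ Maybe.just-injective , V-on-cubicPt x ,
             trans (V-cubicPt l y) (trans (cong (l +_) (sym e)) (trans (+-comm _ _) (-‿inverseʳ _))))
          where
          l : Carrier
          l = - cubic n3 n2 n1 x
        from-shape n3≢0 (perfectCube τ n2≡ n1≡) =
          osculating (just τ) (λ ()) (·-contains⁻¹ n3≢0 (subst (Contains P Q) (perfectCube-plane n3 n2 n1 τ n2≡ n1≡) (V-contains _)))

      secant-or-osculating-at-∞ : SecantOrOsculating nothing P Q
      secant-or-osculating-at-∞ with n3 ≟ 0#
      ... | yes n3≡0 = secant (V 0#) (V-≢zero4 0#) (V-contains 0#)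
        (just 0# , nothing , (λ ()) ,
         trans (V-cubicPt 0# 0#) (solve 3 (λ n1 n2 n3 →
           κ 0 :+ (n3 :* (κ 0 :* κ 0 :* κ 0) :+ n2 :* (κ 0 :* κ 0) :+ n1 :* κ 0) := κ 0) refl n1 n2 n3) ,
         trans (V-P∞ 0#) n3≡0)
      ... | no n3≢0 = from-shape n3≢0 (cubic-shape 2≢0 3≢0 n3 n2 n1 n3≢0)

    secant-or-osculating : ∀ a {P Q} → Independent P Q → Contains P Q (oscAt a) → SecantOrOsculating a P Q
    secant-or-osculating nothing {⟨ _ , _ , _ , _ ⟩} {⟨ _ , _ , _ , _ ⟩} indep (∞P≡0 , ∞Q≡0)
      with trans (sym (oscPlane∞-inner _)) ∞P≡0 | trans (sym (oscPlane∞-inner _)) ∞Q≡0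
    ... | refl | refl = secant-or-osculating-at-∞ indep
    -- The translation by s followed by the reversal t ↦ 1/t sends s to ∞.
    secant-or-osculating (just s) {P} {Q} indep contains =
      subst (λ a → SecantOrOsculating a P Q) (cong just (+-identityˡ s))
        (transport (translation s) (transport reversal
          (secant-or-osculating nothing
            (act-independent reversal (act-independent (translation s) indep))
            (act-contains-oscAt reversal nothing (act-contains-oscAt (translation s) (just 0#)
              (subst (λ t → Contains P Q (oscPlane t)) (sym (+-identityˡ s)) contains))))))

  module _ {P Q : V4} where

    unique-osculating-plane : a₂ P Q ≡ 1 →
      ∃ λ a → Contains P Q (oscAt a) × (∀ b → Contains P Q (oscAt b) → b ≡ a)
    unique-osculating-plane a₂≡1
      with length-filter≡1 (λ π → contains? P Q π ×-dec H1? π) a₂≡1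
    ... | π₀ , _ , (π₀-contains , π₀-osculating) , only-π₀ with osculating⇒oscAt π₀ π₀-osculating
    ...   | a , c , c≢0 , refl = a , ·-contains⁻¹ c≢0 π₀-contains , λ b contains → only-b b contains
      where
      only-b : ∀ b → Contains P Q (oscAt b) → b ≡ a
      only-b b contains with normalize (oscAt b) (oscAt-≢zero4 b)
      ... | d , d≢0 , d·oscAt∈ = oscAt-incident a b (·-incident⁻¹ c≢0 (subst (λ π → inner π (point b) ≡ 0#)
              (only-π₀ d·oscAt∈ (·-contains d contains , oscAt⇒osculating b d d≢0))
              (·-incident d (oscAt-incident-self b))))

    no-secant-plane : b₂ P Q ≡ 0 → c₂ P Q ≡ 0 →
      ∀ v → v ≢ zero4 → Contains P Q v → ¬ TwoPoints v
    no-secant-plane b₂≡0 c₂≡0 v v≢0 contains two with normalize v v≢0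
    ... | c , c≢0 , c·v∈ = excluded (secant-class (c · v) (·-≢zero4 c≢0 v≢0) (·-TwoPoints c two))
      where
      excluded : H2 (c · v) ⊎ H3 (c · v) → ⊥
      excluded (inj₁ h2) = length-filter≡0 (λ π → contains? P Q π ×-dec H2? π) b₂≡0 c·v∈ (·-contains c contains , h2)
      excluded (inj₂ h3) = length-filter≡0 (λ π → contains? P Q π ×-dec H3? π) c₂≡0 c·v∈ (·-contains c contains , h3)

open FieldTheory using (char≢2; char≢3)
open Geometry using (unique-osculating-plane; secant-or-osculating; no-secant-plane; secant; osculating)

mainTheorem9 : (F : FiniteField) →
    ¬ (2 ∣ FiniteField.order F) → ¬ (3 ∣ FiniteField.order F) →
    (P Q : PG3.V4 F) → PG3.Independent F P Q →
    ¬ ((PG3.a₂ F P Q ≡ 1) × (PG3.b₂ F P Q ≡ 0) × (PG3.c₂ F P Q ≡ 0) × (PG3.d₂ F P Q ≥ 1))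
mainTheorem9 F 2∤q 3∤q P Q indep (a₂≡1 , b₂≡0 , c₂≡0 , _)
  with unique-osculating-plane F a₂≡1
... | a , contains , only-a
  with secant-or-osculating F (char≢2 F 2∤q) (char≢3 F 2∤q 3∤q) a indep contains
... | secant v v≢0 v-contains two = no-secant-plane F b₂≡0 c₂≡0 v v≢0 v-contains two
... | osculating b b≢a b-contains = b≢a (only-a b b-contains)
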